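{- Let $m$ be an odd integer with $m \not\equiv 2 \pmod 3$ such that $D = 9m^2+4m$ is square-free, and let $K = \mathbb{Q}(\sqrt{D})$ with class number $h_K$. Then $h_K = 1$ if and only if $m \in \{ -3, 1, 3\}$.
   Context: For every odd integer $m$ (positive or negative), $D = 9m^2+4m > 0$, so $K=\mathbb{Q}(\sqrt{D})$ is a real quadratic field; $h_K$ denotes the order of its (ordinary) ideal class group. -}

module Defs where

open import Data.Nat as ℕ using (ℕ)
import Data.Nat.Divisibility as ℕD
open import Data.Integer using (ℤ; +_; _+_; _*_; _-_; -_; ∣_∣)
open import Data.Integer.Divisibility using (_∣_)
open import Data.Vec using (Vec; []; _∷_)
open import Data.Product using (Σ; _×_; ∃-syntax)
open import Relation.Binary.PropositionalEquality using (_≡_)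
open import Relation.Nullary using (¬_)

Dm : ℤ → ℤ
Dm m = (+ 9) * (m * m) + (+ 4) * m

SquareFreeℕ : ℕ → Set
SquareFreeℕ n = ∀ (k : ℕ) → (k ℕ.* k) ℕD.∣ n → k ≡ 1

SquareFree : ℤ → Set
SquareFree d = SquareFreeℕ ∣ d ∣

Odd : ℤ → Set
Odd m = ¬ ((+ 2) ∣ m)

-- Elements of the ring of integers O_K of K = Q(√d) (d square-free):
-- the element (x + y √d) / 2, with x y ∈ ℤ, is an algebraic integer iff
-- its norm (x² - d y²)/4 is an integer (its trace is x ∈ ℤ).
record OK (d : ℤ) : Set where
  constructor mkOK
  field
    x : ℤ
    y : ℤ
    integral : (+ 4) ∣ (x * x - d * (y * y))
open OK public

-- 4·(r·g) = (rx gx + d ry gy) + (rx gy + ry gx) √d ; coordinates of 4·(r·g)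
-- (w.r.t. the basis 1, √d) summed over a linear combination Σ rᵢ gᵢ.
sumRe : {d : ℤ} {n : ℕ} → Vec (OK d) n → Vec (OK d) n → ℤ
sumRe [] [] = + 0
sumRe {d} (r ∷ rs) (g ∷ gs) = (x r * x g + d * (y r * y g)) + sumRe rs gs

sumIm : {d : ℤ} {n : ℕ} → Vec (OK d) n → Vec (OK d) n → ℤ
sumIm [] [] = + 0
sumIm (r ∷ rs) (g ∷ gs) = (x r * y g + y r * x g) + sumIm rs gs

-- z lies in the ideal of O_K generated by gs:  z = Σ rᵢ gᵢ with rᵢ ∈ O_K.
-- (z = (zx + zy √d)/2, so 4z = 2zx + 2zy √d.)
InIdeal : {d : ℤ} {n : ℕ} → Vec (OK d) n → OK d → Set
InIdeal {d} {n} gs z =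
  ∃[ rs ] ((+ 2) * x z ≡ sumRe {d} {n} rs gs × (+ 2) * y z ≡ sumIm {d} {n} rs gs)

Principal : {d : ℤ} {n : ℕ} → Vec (OK d) n → Set
Principal {d} gs =
  ∃[ α ] (∀ (z : OK d) → (InIdeal gs z → InIdeal (α ∷ []) z)
                       × (InIdeal (α ∷ []) z → InIdeal gs z))

-- h_K = 1 : every ideal of O_K is principal. Since O_K is Noetherian every ideal
-- is finitely generated, so it suffices (and is equivalent) to quantify over
-- finite generating families.
ClassNumberOne : ℤ → Set
ClassNumberOne d = ∀ (n : ℕ) (gs : Vec (OK d) n) → Principal gs

-- Write m = 2j + 1.  Then D = 9m² + 4m = 4k + 1 with k = 9j² + 11j + 3, and the ring of integers
-- of K is ℤ[ω] with ω² = ω + k, where a + bω has norm a² + ab - kb².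
--
-- As m ≢ 2 (mod 3), 3 divides N(j + ω) = -m(2m + 1), so a generator
-- of the ideal (3, j + ω) has norm ±3: (X, Y) = (2a + b, b) solves X² - DY² = ±12.  Multiplication by
-- the unit ε = (t + 3)/2 - 3ω of norm 1, where t = |9m + 2| and t² = 9D + 4, maps a solution with
-- X, Y ≥ 0 to one with a smaller |Y| as soon as t ≥ 31, and Y = 0 is impossible.  This leaves
-- m ∈ {-3, -1, 1, 3}, and m = -1 ≡ 2 (mod 3).
--
-- Conversely, for D = 13, 69, 93 every ideal is principal.  Finitely generated ideals are principal
-- once two-generator ones are; dividing out a conjugate and the content brings (α, β) to the form
-- (a, B + ω) with a ∣ N(B + ω), and the reduction (a, B) ↦ (N(B + ω)/a, -B - 1) of binary quadratic
-- forms ends at |2B + 1| ≤ |a| ≤ |N(B + ω)/a|, which forces 4a² ≤ D.  The few ideals left are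
-- checked by hand.

module Submission where

open import Algebra.Bundles using (CommutativeRing)
open import Algebra.Structures using (IsCommutativeRing)
open import Data.Empty using (⊥; ⊥-elim)
open import Data.Integer as ℤ using (ℤ; +_; -[1+_]; _+_; _*_; _-_; -_; ∣_∣)
open import Data.Integer.DivMod using (_/ℕ_; _%ℕ_; n%ℕd<d; a≡a%ℕn+[a/ℕn]*n)
open import Data.Integer.Divisibility using (_∣_)
open import Data.Integer.Divisibility.Signed using (divides; ∣⇒∣ᵤ; ∣ᵤ⇒∣; ∣m+n∣m⇒∣n)
import Data.Integer.Properties as ℤ
open import Data.Integer.Tactic.RingSolver using (solve-∀)
open import Data.Maybe using (Maybe; just; nothing)
open import Data.Nat as ℕ using (ℕ; zero; suc; z≤n; s≤s)
import Data.Nat.Divisibility as ℕ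
open import Data.Nat.DivMod as ℕ using ()
open import Data.Nat.GCD as ℕ using (module Bézout; module GCD)
open import Data.Nat.Induction using (<-wellFounded)
open import Data.Nat.Primality using (Prime; euclidsLemma; prime⇒nonTrivial; prime⇒nonZero; prime?)
import Data.Nat.Properties as ℕ
import Data.Nat.Tactic.RingSolver as ℕSolver
open import Data.Product using (∃₂; ∃-syntax; _×_; _,_; proj₁; proj₂; uncurry)
open import Data.Sum as Sum using (_⊎_; inj₁; inj₂)
open import Data.Vec as Vec using (Vec; []; _∷_)
open import Data.Vec.Relation.Unary.All as All using (All; []; _∷_)
open import Function using (_∘_)
open import Induction.WellFounded using (Acc; acc)
open import Relation.Binary.PropositionalEquality
open import Relation.Nullary using (¬_; yes; no)
open import Relation.Nullary.Decidable using (from-yes; from-no)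
import Tactic.RingSolver as RingSolver
import Tactic.RingSolver.Core.AlmostCommutativeRing as ACR

open import Defs using (Dm; Odd; SquareFree; OK; mkOK; sumRe; sumIm; InIdeal; ClassNumberOne)

-- Integer arithmetic

parity : ∀ i → ∃[ q ] (i ≡ + 2 * q ⊎ i ≡ + 2 * q + + 1)
parity i with i %ℕ 2 | n%ℕd<d i 2 | a≡a%ℕn+[a/ℕn]*n i 2
... | 0 | _ | eq = q , inj₁ (trans eq (trans (ℤ.+-identityˡ (q * + 2)) (ℤ.*-comm q (+ 2))))
  where q = i /ℕ 2
... | 1 | _ | eq = q , inj₂ (trans eq (trans (ℤ.+-comm (+ 1) (q * + 2)) (cong (_+ + 1) (ℤ.*-comm q (+ 2)))))
  where q = i /ℕ 2
... | suc (suc _) | s≤s (s≤s ()) | _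

odd⇒≡2j+1 : ∀ m → Odd m → ∃[ j ] m ≡ + 2 * j + + 1
odd⇒≡2j+1 m odd with parity m
... | q , inj₁ m≡2q = ⊥-elim (odd (∣⇒∣ᵤ (divides q (trans m≡2q (ℤ.*-comm (+ 2) q)))))
... | q , inj₂ m≡2q+1 = q , m≡2q+1

2∤2i+1 : ∀ i → ¬ (+ 2 ∣ + 2 * i + + 1)
2∤2i+1 i 2∣2i+1 = contradiction-2∣1 (∣⇒∣ᵤ (∣m+n∣m⇒∣n (∣ᵤ⇒∣ 2∣2i+1) (divides i (ℤ.*-comm (+ 2) i))))
  where
  contradiction-2∣1 : ¬ (+ 2 ∣ + 1)
  contradiction-2∣1 2∣1 with ℕ.∣1⇒≡1 2∣1
  ... | ()

i≡i-j+j : ∀ i j → i ≡ i - j + j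
i≡i-j+j = solve-∀

i≡i+j-j : ∀ i j → i ≡ i + j - j
i≡i+j-j = solve-∀

-- For d ≡ 1 (mod 4), x² - d y² ≡ x - y (mod 2).
4∣x²-dy²⇒x≡y[mod2] : ∀ k x y → + 4 ∣ x * x - (+ 4 * k + + 1) * (y * y) → ∃[ p ] x ≡ + 2 * p + y
4∣x²-dy²⇒x≡y[mod2] k x y 4∣N with parity (x - y)
... | p , inj₁ x-y≡2p = p , trans (i≡i-j+j x y) (cong (_+ y) x-y≡2p)
... | p , inj₂ x-y≡2p+1 = ⊥-elim (2∤2i+1 s (ℕ.∣-trans (ℕ.divides 2 refl) (subst (+ 4 ∣_) N-odd 4∣N)))
  where
  s = + 2 * p * p + + 2 * p * y + + 2 * p + y - + 2 * k * (y * y)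
  N-odd : x * x - (+ 4 * k + + 1) * (y * y) ≡ + 2 * s + + 1
  N-odd = trans (cong (λ x → x * x - (+ 4 * k + + 1) * (y * y)) (trans (i≡i-j+j x y) (cong (_+ y) x-y≡2p+1)))
                (expand k p y)
    where
    expand : ∀ k p y → (+ 2 * p + + 1 + y) * (+ 2 * p + + 1 + y) - (+ 4 * k + + 1) * (y * y)
                     ≡ + 2 * (+ 2 * p * p + + 2 * p * y + + 2 * p + y - + 2 * k * (y * y)) + + 1
    expand = solve-∀

¬3∣m-2⇒3∣m[2m+1] : ∀ m → ¬ (+ 3 ∣ m - + 2) → ∃[ h ] m * (+ 2 * m + + 1) ≡ + 3 * h
¬3∣m-2⇒3∣m[2m+1] m 3∤m-2 with m %ℕ 3 | n%ℕd<d m 3 | a≡a%ℕn+[a/ℕn]*n m 3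
... | 0 | _ | m≡3q = q * (+ 2 * m + + 1) , trans (cong (_* (+ 2 * m + + 1)) m≡3q) (factor q (+ 2 * m + + 1))
  where
  q = m /ℕ 3
  factor : ∀ q w → (+ 0 + q * + 3) * w ≡ + 3 * (q * w)
  factor = solve-∀
... | 1 | _ | m≡3q+1 = m * (+ 2 * q + + 1) , trans (cong (λ n → m * (+ 2 * n + + 1)) m≡3q+1) (factor m q)
  where
  q = m /ℕ 3
  factor : ∀ m q → m * (+ 2 * (+ 1 + q * + 3) + + 1) ≡ + 3 * (m * (+ 2 * q + + 1))
  factor = solve-∀
... | 2 | _ | m≡3q+2 = ⊥-elim (3∤m-2 (∣⇒∣ᵤ (divides q (trans (cong (_- + 2) m≡3q+2) (cancel q)))))
  where
  q = m /ℕ 3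
  cancel : ∀ q → + 2 + q * + 3 - + 2 ≡ q * + 3
  cancel = solve-∀
... | suc (suc (suc _)) | s≤s (s≤s (s≤s ())) | _

+∣i∣≡±i : ∀ i → ∃[ σ ] + ∣ i ∣ ≡ σ * i
+∣i∣≡±i (+ n) = + 1 , sym (ℤ.*-identityˡ (+ n))
+∣i∣≡±i -[1+ n ] = - + 1 , sym (ℤ.-1*i≡-i -[1+ n ])

+∣i∣*+∣i∣≡i*i : ∀ i → + ∣ i ∣ * + ∣ i ∣ ≡ i * i
+∣i∣*+∣i∣≡i*i (+ n) = refl
+∣i∣*+∣i∣≡i*i -[1+ n ] = refl

d+bn≡am⇒d≡am-bn : ∀ d a b m n → d ℕ.+ b ℕ.* n ≡ a ℕ.* m → + d ≡ + a * + m - + b * + n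
d+bn≡am⇒d≡am-bn d a b m n eq = begin
  + d                          ≡⟨ i≡i+j-j (+ d) (+ (b ℕ.* n)) ⟩
  + d + + (b ℕ.* n) - + (b ℕ.* n) ≡⟨ cong (λ i → i - + (b ℕ.* n)) (trans (sym (ℤ.pos-+ d (b ℕ.* n))) (cong +_ eq)) ⟩
  + (a ℕ.* m) - + (b ℕ.* n)    ≡⟨ cong₂ _-_ (ℤ.pos-* a m) (ℤ.pos-* b n) ⟩
  + a * + m - + b * + n        ∎
  where open ≡-Reasoning

record Gcd₂ (x y : ℤ) : Set where
  field
    g s t x/g y/g : ℤ
    g≡sx+ty : g ≡ s * x + t * y
    x≡x/g*g : x ≡ x/g * g
    y≡y/g*g : y ≡ y/g * g

record Gcd₃ (x y z : ℤ) : Set where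
  field
    g s₁ s₂ s₃ x/g y/g z/g : ℤ
    g≡s₁x+s₂y+s₃z : g ≡ s₁ * x + s₂ * y + s₃ * z
    x≡x/g*g : x ≡ x/g * g
    y≡y/g*g : y ≡ y/g * g
    z≡z/g*g : z ≡ z/g * g

gcd₂ : ∀ x y → Gcd₂ x y
gcd₂ x y with Bézout.lemma ∣ x ∣ ∣ y ∣
... | Bézout.result d isGcd identity
      with ∣ᵤ⇒∣ {+ d} {x} (GCD.gcd∣m isGcd) | ∣ᵤ⇒∣ {+ d} {y} (GCD.gcd∣n isGcd) | +∣i∣≡±i x | +∣i∣≡±i y
... | divides x/g x≡ | divides y/g y≡ | σ , ∣x∣≡σx | τ , ∣y∣≡τy with identity
...   | Bézout.+- a b eq = record
  { g = + d ; s = + a * σ ; t = - (+ b * τ) ; x/g = x/g ; y/g = y/g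
  ; g≡sx+ty = trans (d+bn≡am⇒d≡am-bn d a b _ _ eq)
                    (trans (cong₂ (λ X Y → + a * X - + b * Y) ∣x∣≡σx ∣y∣≡τy) (regroup (+ a) σ x (+ b) τ y))
  ; x≡x/g*g = x≡ ; y≡y/g*g = y≡ }
  where
  regroup : ∀ a σ x b τ y → a * (σ * x) - b * (τ * y) ≡ a * σ * x + - (b * τ) * y
  regroup = solve-∀
...   | Bézout.-+ a b eq = record
  { g = + d ; s = - (+ a * σ) ; t = + b * τ ; x/g = x/g ; y/g = y/g
  ; g≡sx+ty = trans (d+bn≡am⇒d≡am-bn d b a _ _ eq)
                    (trans (cong₂ (λ Y X → + b * Y - + a * X) ∣y∣≡τy ∣x∣≡σx) (regroup (+ a) σ x (+ b) τ y))
  ; x≡x/g*g = x≡ ; y≡y/g*g = y≡ }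
  where
  regroup : ∀ a σ x b τ y → b * (τ * y) - a * (σ * x) ≡ - (a * σ) * x + b * τ * y
  regroup = solve-∀

gcd₃ : ∀ x y z → Gcd₃ x y z
gcd₃ x y z = record
  { g = g ; s₁ = s′ * s ; s₂ = s′ * t ; s₃ = t′ ; x/g = x/g₁ * g₁/g ; y/g = y/g₁ * g₁/g ; z/g = z/g
  ; g≡s₁x+s₂y+s₃z = trans g≡s′g₁+t′z (trans (cong (λ h → s′ * h + t′ * z) g₁≡sx+ty) (regroup s′ s x t y t′ z))
  ; x≡x/g*g = through x/g₁ x≡x/g₁*g₁
  ; y≡y/g*g = through y/g₁ y≡y/g₁*g₁
  ; z≡z/g*g = z≡z/g*g }
  where
  open Gcd₂ (gcd₂ x y) renaming (g to g₁; x/g to x/g₁; y/g to y/g₁; x≡x/g*g to x≡x/g₁*g₁; y≡y/g*g to y≡y/g₁*g₁; g≡sx+ty to g₁≡sx+ty)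
  open Gcd₂ (gcd₂ g₁ z)
    renaming (s to s′; t to t′; x/g to g₁/g; y/g to z/g; g≡sx+ty to g≡s′g₁+t′z; x≡x/g*g to g₁≡g₁/g*g; y≡y/g*g to z≡z/g*g)
  regroup : ∀ s′ s x t y t′ z → s′ * (s * x + t * y) + t′ * z ≡ s′ * s * x + s′ * t * y + t′ * z
  regroup = solve-∀
  through : ∀ {w} q → w ≡ q * g₁ → w ≡ q * g₁/g * g
  through {w} q w≡qg₁ = trans w≡qg₁ (trans (cong (q *_) g₁≡g₁/g*g) (sym (ℤ.*-assoc q g₁/g g)))

∣m⊖n∣≤o : ∀ m n o → m ℕ.≤ n ℕ.+ o → n ℕ.≤ m ℕ.+ o → ∣ m ℤ.⊖ n ∣ ℕ.≤ o
∣m⊖n∣≤o m n o m≤n+o n≤m+o with ℕ.≤-total m n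
... | inj₁ m≤n = subst (ℕ._≤ o) (sym (ℤ.∣⊖∣-≤ m≤n)) (ℕ.m≤n+o⇒m∸n≤o n m n≤m+o)
... | inj₂ n≤m = subst (ℕ._≤ o) (sym (trans (ℤ.∣m⊖n∣≡∣n⊖m∣ m n) (ℤ.∣⊖∣-≤ n≤m))) (ℕ.m≤n+o⇒m∸n≤o m n m≤n+o)

∣m⊖n∣<o : ∀ m n o .{{_ : ℕ.NonZero o}} → m ℕ.< n ℕ.+ o → n ℕ.< m ℕ.+ o → ∣ m ℤ.⊖ n ∣ ℕ.< o
∣m⊖n∣<o m n o m<n+o n<m+o with ℕ.≤-total m n
... | inj₁ m≤n = subst (ℕ._< o) (sym (ℤ.∣⊖∣-≤ m≤n)) (ℕ.m<n+o⇒m∸n<o n m n<m+o)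
... | inj₂ n≤m = subst (ℕ._< o) (sym (trans (ℤ.∣m⊖n∣≡∣n⊖m∣ m n) (ℤ.∣⊖∣-≤ n≤m))) (ℕ.m<n+o⇒m∸n<o m n m<n+o)

record SymmetricResidue (a B : ℤ) : Set where
  field
    q r : ℤ
    B≡r+aq : B ≡ r + a * q
    ∣2r+1∣≤∣a∣ : ∣ + 2 * r + + 1 ∣ ℕ.≤ ∣ a ∣

-- B is shifted by h = ⌊|a|/2⌋ so that the residue in [0, |a|) becomes one in [-h, |a| - h).
symmetricResidue : ∀ a B → a ≢ + 0 → SymmetricResidue a B
symmetricResidue a B a≢0 = record { q = Q * σ ; r = + ρ - + h ; B≡r+aq = B≡r+aq ; ∣2r+1∣≤∣a∣ = bound }
  where
  A = ∣ a ∣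
  instance
    A≢0 : ℕ.NonZero A
    A≢0 = ℕ.≢-nonZero (λ A≡0 → a≢0 (ℤ.∣i∣≡0⇒i≡0 A≡0))
  h = A ℕ./ 2
  ρ = (B + + h) %ℕ A
  Q = (B + + h) /ℕ A
  σ = proj₁ (+∣i∣≡±i a)
  B≡r+aq : B ≡ + ρ - + h + a * (Q * σ)
  B≡r+aq = begin
    B                       ≡⟨ i≡i+j-j B (+ h) ⟩
    B + + h - + h           ≡⟨ cong (_- + h) (a≡a%ℕn+[a/ℕn]*n (B + + h) A) ⟩
    + ρ + Q * + A - + h     ≡⟨ cong (λ i → + ρ + Q * i - + h) (proj₂ (+∣i∣≡±i a)) ⟩
    + ρ + Q * (σ * a) - + h ≡⟨ regroup (+ ρ) Q σ a (+ h) ⟩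
    + ρ - + h + a * (Q * σ) ∎
    where
    open ≡-Reasoning
    regroup : ∀ ρ Q σ a h → ρ + Q * (σ * a) - h ≡ ρ - h + a * (Q * σ)
    regroup = solve-∀
  A≡A%2+2h : A ≡ A ℕ.% 2 ℕ.+ h ℕ.* 2
  A≡A%2+2h = ℕ.m≡m%n+[m/n]*n A 2
  upper : 2 ℕ.* ρ ℕ.+ 1 ℕ.≤ h ℕ.* 2 ℕ.+ A
  upper = ℕ.≤-pred (begin
    suc (2 ℕ.* ρ ℕ.+ 1) ≡⟨ double-suc ρ ⟩
    2 ℕ.* suc ρ         ≤⟨ ℕ.*-monoʳ-≤ 2 (n%ℕd<d (B + + h) A) ⟩
    2 ℕ.* A             ≡⟨ ℕ.+-comm A (A ℕ.+ 0) ⟩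
    A ℕ.+ 0 ℕ.+ A       ≤⟨ ℕ.+-monoˡ-≤ A (ℕ.≤-trans (ℕ.≤-reflexive (ℕ.+-identityʳ A)) A≤1+2h) ⟩
    suc (h ℕ.* 2) ℕ.+ A ∎)
    where
    open ℕ.≤-Reasoning
    A≤1+2h : A ℕ.≤ suc (h ℕ.* 2)
    A≤1+2h = ℕ.≤-trans (ℕ.≤-reflexive A≡A%2+2h) (ℕ.+-monoˡ-≤ (h ℕ.* 2) (ℕ.≤-pred (ℕ.m%n<n A 2)))
    double-suc : ∀ ρ → suc (2 ℕ.* ρ ℕ.+ 1) ≡ 2 ℕ.* suc ρ
    double-suc = ℕSolver.solve-∀
  lower : h ℕ.* 2 ℕ.≤ 2 ℕ.* ρ ℕ.+ 1 ℕ.+ A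
  lower = ℕ.≤-trans (ℕ.m≤n+m (h ℕ.* 2) (A ℕ.% 2)) (ℕ.≤-trans (ℕ.≤-reflexive (sym A≡A%2+2h)) (ℕ.m≤n+m A _))
  bound : ∣ + 2 * (+ ρ - + h) + + 1 ∣ ℕ.≤ A
  bound = subst (ℕ._≤ A) (cong ∣_∣ (sym 2r+1≡)) (∣m⊖n∣≤o _ _ A upper lower)
    where
    2r+1≡ : + 2 * (+ ρ - + h) + + 1 ≡ (2 ℕ.* ρ ℕ.+ 1) ℤ.⊖ (h ℕ.* 2)
    2r+1≡ = begin
      + 2 * (+ ρ - + h) + + 1                ≡⟨ regroup (+ ρ) (+ h) ⟩
      + 2 * + ρ + + 1 - + h * + 2            ≡⟨ cong₂ (λ i j → i + + 1 - j) (sym (ℤ.pos-* 2 ρ)) (sym (ℤ.pos-* h 2)) ⟩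
      + (2 ℕ.* ρ) + + 1 - + (h ℕ.* 2)        ≡⟨ cong (_- + (h ℕ.* 2)) (sym (ℤ.pos-+ (2 ℕ.* ρ) 1)) ⟩
      + (2 ℕ.* ρ ℕ.+ 1) - + (h ℕ.* 2)        ≡⟨ ℤ.m-n≡m⊖n (2 ℕ.* ρ ℕ.+ 1) (h ℕ.* 2) ⟩
      (2 ℕ.* ρ ℕ.+ 1) ℤ.⊖ (h ℕ.* 2)            ∎
      where
      open ≡-Reasoning
      regroup : ∀ ρ h → + 2 * (ρ - h) + + 1 ≡ + 2 * ρ + + 1 - h * + 2
      regroup = solve-∀

-- The order ℤ[ω], ω² = ω + k

module QuadraticIntegers (k : ℤ) where

  -- a +ω b stands for a + b ω, where ω² = ω + k.  The record has no η so that the ring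
  -- operations stay folded on variables, as the reflective ring solver requires; in _⊗_
  -- the factor k comes last so that products of integer constants compute.
  infix 5 _+ω_
  record ℤ[ω] : Set where
    no-eta-equality
    pattern
    constructor _+ω_
    field
      re im : ℤ
  open ℤ[ω] public

  infixl 6 _⊕_
  infixl 7 _⊗_
  infix 8 ⊖_

  _⊕_ _⊗_ : ℤ[ω] → ℤ[ω] → ℤ[ω]
  (a +ω b) ⊕ (c +ω d) = a + c +ω b + d
  (a +ω b) ⊗ (c +ω d) = a * c + b * d * k +ω a * d + b * c + b * d

  ⊖_ : ℤ[ω] → ℤ[ω]
  ⊖ (a +ω b) = - a +ω - b

  ι : ℤ → ℤ[ω]
  ι n = n +ω + 0

  0ω 1ω : ℤ[ω]
  0ω = ι (+ 0)
  1ω = ι (+ 1)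

  conj : ℤ[ω] → ℤ[ω]
  conj (a +ω b) = a + b +ω - b

  norm trace : ℤ[ω] → ℤ
  norm (a +ω b) = a * a + a * b - k * (b * b)
  trace (a +ω b) = + 2 * a + b

  ≡ω : ∀ {a b c d} → a ≡ c → b ≡ d → a +ω b ≡ c +ω d
  ≡ω = cong₂ _+ω_

  isCommutativeRing : IsCommutativeRing _≡_ _⊕_ _⊗_ ⊖_ 0ω 1ω
  isCommutativeRing = record
    { isRing = record
      { +-isAbelianGroup = record
        { isGroup = record
          { isMonoid = record
            { isSemigroup = record
              { isMagma = record { isEquivalence = isEquivalence ; ∙-cong = cong₂ _⊕_ }
              ; assoc = λ { (a +ω b) (c +ω d) (e +ω f) → ≡ω (ℤ.+-assoc a c e) (ℤ.+-assoc b d f) } }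
            ; identity = (λ { (a +ω b) → ≡ω (ℤ.+-identityˡ a) (ℤ.+-identityˡ b) })
                       , (λ { (a +ω b) → ≡ω (ℤ.+-identityʳ a) (ℤ.+-identityʳ b) }) }
          ; inverse = (λ { (a +ω b) → ≡ω (ℤ.+-inverseˡ a) (ℤ.+-inverseˡ b) })
                    , (λ { (a +ω b) → ≡ω (ℤ.+-inverseʳ a) (ℤ.+-inverseʳ b) })
          ; ⁻¹-cong = cong ⊖_ }
        ; comm = λ { (a +ω b) (c +ω d) → ≡ω (ℤ.+-comm a c) (ℤ.+-comm b d) } }
      ; *-cong = cong₂ _⊗_
      ; *-assoc = λ { (a +ω b) (c +ω d) (e +ω f) → ≡ω (assoc-re a b c d e f k) (assoc-im a b c d e f k) }
      ; *-identity = (λ { (a +ω b) → ≡ω (identityˡ-re a b k) (identityˡ-im a b) })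
                   , (λ { (a +ω b) → ≡ω (identityʳ-re a b k) (identityʳ-im a b) })
      ; distrib = (λ { (a +ω b) (c +ω d) (e +ω f) → ≡ω (distribˡ-re a b c d e f k) (distribˡ-im a b c d e f) })
                , (λ { (a +ω b) (c +ω d) (e +ω f) → ≡ω (distribʳ-re a b c d e f k) (distribʳ-im a b c d e f) }) }
    ; *-comm = λ { (a +ω b) (c +ω d) → ≡ω (comm-re a b c d k) (comm-im a b c d) } }
    where
    assoc-re : ∀ a b c d e f k → (a * c + b * d * k) * e + (a * d + b * c + b * d) * f * k
                               ≡ a * (c * e + d * f * k) + b * (c * f + d * e + d * f) * k
    assoc-re = solve-∀
    assoc-im : ∀ a b c d e f k → (a * c + b * d * k) * f + (a * d + b * c + b * d) * e + (a * d + b * c + b * d) * f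
                               ≡ a * (c * f + d * e + d * f) + b * (c * e + d * f * k) + b * (c * f + d * e + d * f)
    assoc-im = solve-∀
    identityˡ-re : ∀ a b k → + 1 * a + + 0 * b * k ≡ a
    identityˡ-re = solve-∀
    identityˡ-im : ∀ a b → + 1 * b + + 0 * a + + 0 * b ≡ b
    identityˡ-im = solve-∀
    identityʳ-re : ∀ a b k → a * + 1 + b * + 0 * k ≡ a
    identityʳ-re = solve-∀
    identityʳ-im : ∀ a b → a * + 0 + b * + 1 + b * + 0 ≡ b
    identityʳ-im = solve-∀
    distribˡ-re : ∀ a b c d e f k → a * (c + e) + b * (d + f) * k ≡ a * c + b * d * k + (a * e + b * f * k)
    distribˡ-re = solve-∀
    distribˡ-im : ∀ a b c d e f → a * (d + f) + b * (c + e) + b * (d + f) ≡ a * d + b * c + b * d + (a * f + b * e + b * f)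
    distribˡ-im = solve-∀
    distribʳ-re : ∀ a b c d e f k → (c + e) * a + (d + f) * b * k ≡ c * a + d * b * k + (e * a + f * b * k)
    distribʳ-re = solve-∀
    distribʳ-im : ∀ a b c d e f → (c + e) * b + (d + f) * a + (d + f) * b ≡ c * b + d * a + d * b + (e * b + f * a + f * b)
    distribʳ-im = solve-∀
    comm-re : ∀ a b c d k → a * c + b * d * k ≡ c * a + d * b * k
    comm-re = solve-∀
    comm-im : ∀ a b c d → a * d + b * c + b * d ≡ c * b + d * a + d * b
    comm-im = solve-∀

  commutativeRing : CommutativeRing _ _
  commutativeRing = record { isCommutativeRing = isCommutativeRing }

  ring : ACR.AlmostCommutativeRing _ _
  ring = ACR.fromCommutativeRing commutativeRing 0ω≟
    where
    0ω≟ : ∀ x → Maybe (0ω ≡ x)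
    0ω≟ (+ 0 +ω + 0) = just refl
    0ω≟ _ = nothing

  open CommutativeRing commutativeRing public
    using () renaming (*-comm to ⊗-comm; *-assoc to ⊗-assoc; *-identityʳ to ⊗-identityʳ; +-comm to ⊕-comm; +-identityʳ to ⊕-identityʳ)

  ι-* : ∀ m n → ι (m * n) ≡ ι m ⊗ ι n
  ι-* m n = ≡ω (expand-re m n k) (expand-im m n)
    where
    expand-re : ∀ m n k → m * n ≡ m * n + + 0 * + 0 * k
    expand-re = solve-∀
    expand-im : ∀ m n → + 0 ≡ m * + 0 + + 0 * n + + 0 * + 0
    expand-im = solve-∀

  ι⊗ : ∀ n a b → ι n ⊗ (a +ω b) ≡ n * a +ω n * b
  ι⊗ n a b = ≡ω (expand-re n a b k) (expand-im n a b)
    where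
    expand-re : ∀ n a b k → n * a + + 0 * b * k ≡ n * a
    expand-re = solve-∀
    expand-im : ∀ n a b → n * b + + 0 * a + + 0 * b ≡ n * b
    expand-im = solve-∀

  im-ι⊗ : ∀ n x → im (ι n ⊗ x) ≡ n * im x
  im-ι⊗ n (a +ω b) = cong im (ι⊗ n a b)

  trace-ι⊗ : ∀ n x → trace (ι n ⊗ x) ≡ n * trace x
  trace-ι⊗ n (a +ω b) = trans (cong trace (ι⊗ n a b)) (regroup n a b)
    where
    regroup : ∀ n a b → + 2 * (n * a) + n * b ≡ n * (+ 2 * a + b)
    regroup = solve-∀

  ι-cancel : ∀ {n x y} → n ≢ + 0 → ι n ⊗ x ≡ ι n ⊗ y → x ≡ y
  ι-cancel {n} {a +ω b} {c +ω d} n≢0 eq = ≡ω (cancel (cong re eq′)) (cancel (cong im eq′))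
    where
    eq′ = trans (sym (ι⊗ n a b)) (trans eq (ι⊗ n c d))
    cancel : ∀ {i j} → n * i ≡ n * j → i ≡ j
    cancel {i} {j} = ℤ.*-cancelˡ-≡ n i j {{ℤ.≢-nonZero n≢0}}

  conj-⊕ : ∀ x y → conj (x ⊕ y) ≡ conj x ⊕ conj y
  conj-⊕ (a +ω b) (c +ω d) = ≡ω (regroup a b c d) (ℤ.neg-distrib-+ b d)
    where
    regroup : ∀ a b c d → a + c + (b + d) ≡ a + b + (c + d)
    regroup = solve-∀

  conj-⊗ : ∀ x y → conj (x ⊗ y) ≡ conj x ⊗ conj y
  conj-⊗ (a +ω b) (c +ω d) = ≡ω (expand-re a b c d k) (expand-im a b c d)
    where
    expand-re : ∀ a b c d k → a * c + b * d * k + (a * d + b * c + b * d)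
                            ≡ (a + b) * (c + d) + - b * - d * k
    expand-re = solve-∀
    expand-im : ∀ a b c d → - (a * d + b * c + b * d) ≡ (a + b) * - d + - b * (c + d) + - b * - d
    expand-im = solve-∀

  conj-involutive : ∀ x → conj (conj x) ≡ x
  conj-involutive (a +ω b) = ≡ω (cancel a b) (ℤ.neg-involutive b)
    where
    cancel : ∀ a b → a + b + - b ≡ a
    cancel = solve-∀

  conj-ι : ∀ n → conj (ι n) ≡ ι n
  conj-ι n = ≡ω (ℤ.+-identityʳ n) refl

  im-conj : ∀ x → im (conj x) ≡ - im x
  im-conj (a +ω b) = refl

  trace-conj : ∀ x → trace (conj x) ≡ trace x
  trace-conj (a +ω b) = expand a b
    where
    expand : ∀ a b → + 2 * (a + b) + - b ≡ + 2 * a + b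
    expand = solve-∀

  im-⊖ : ∀ x → im (⊖ x) ≡ - im x
  im-⊖ (a +ω b) = refl

  trace-⊖ : ∀ x → trace (⊖ x) ≡ - trace x
  trace-⊖ (a +ω b) = expand a b
    where
    expand : ∀ a b → + 2 * - a + - b ≡ - (+ 2 * a + b)
    expand = solve-∀

  norm-⊖ : ∀ x → norm (⊖ x) ≡ norm x
  norm-⊖ (a +ω b) = expand a b k
    where
    expand : ∀ a b k → - a * - a + - a * - b - k * (- b * - b) ≡ a * a + a * b - k * (b * b)
    expand = solve-∀

  x⊗conj[x]≡ι[norm[x]] : ∀ x → x ⊗ conj x ≡ ι (norm x)
  x⊗conj[x]≡ι[norm[x]] (a +ω b) = ≡ω (expand-re a b k) (expand-im a b)
    where
    expand-re : ∀ a b k → a * (a + b) + b * - b * k ≡ a * a + a * b - k * (b * b)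
    expand-re = solve-∀
    expand-im : ∀ a b → a * - b + b * (a + b) + b * - b ≡ + 0
    expand-im = solve-∀

  norm-⊗ : ∀ x y → norm (x ⊗ y) ≡ norm x * norm y
  norm-⊗ (a +ω b) (c +ω d) = multiplicative a b c d k
    where
    multiplicative : ∀ a b c d k →
      (a * c + b * d * k) * (a * c + b * d * k) + (a * c + b * d * k) * (a * d + b * c + b * d)
        - k * ((a * d + b * c + b * d) * (a * d + b * c + b * d))
      ≡ (a * a + a * b - k * (b * b)) * (c * c + c * d - k * (d * d))
    multiplicative = solve-∀

  norm-conj : ∀ x → norm (conj x) ≡ norm x
  norm-conj (a +ω b) = expand a b k
    where
    expand : ∀ a b k → (a + b) * (a + b) + (a + b) * - b - k * (- b * - b) ≡ a * a + a * b - k * (b * b)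
    expand = solve-∀

  norm-ι : ∀ n → norm (ι n) ≡ n * n
  norm-ι n = expand n k
    where
    expand : ∀ n k → n * n + n * + 0 - k * (+ 0 * + 0) ≡ n * n
    expand = solve-∀

  norm-⊕ : ∀ x y → norm (x ⊕ y) ≡ norm x + norm y + trace (x ⊗ conj y)
  norm-⊕ (a +ω b) (c +ω d) = expand a b c d k
    where
    expand : ∀ a b c d k → (a + c) * (a + c) + (a + c) * (b + d) - k * ((b + d) * (b + d))
           ≡ a * a + a * b - k * (b * b) + (c * c + c * d - k * (d * d))
             + (+ 2 * (a * (c + d) + b * - d * k) + (a * - d + b * (c + d) + b * - d))
    expand = solve-∀

  trace-⊕ : ∀ x y → trace (x ⊕ y) ≡ trace x + trace y
  trace-⊕ (a +ω b) (c +ω d) = regroup a b c d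
    where
    regroup : ∀ a b c d → + 2 * (a + c) + (b + d) ≡ + 2 * a + b + (+ 2 * c + d)
    regroup = solve-∀

  im-⊕ : ∀ x y → im (x ⊕ y) ≡ im x + im y
  im-⊕ (a +ω b) (c +ω d) = refl

  trace-⊗ : ∀ x y → + 2 * trace (x ⊗ y) ≡ trace x * trace y + (+ 4 * k + + 1) * (im x * im y)
  trace-⊗ (a +ω b) (c +ω d) = expand a b c d k
    where
    expand : ∀ a b c d k → + 2 * (+ 2 * (a * c + b * d * k) + (a * d + b * c + b * d))
                         ≡ (+ 2 * a + b) * (+ 2 * c + d) + (+ 4 * k + + 1) * (b * d)
    expand = solve-∀

  im-⊗ : ∀ x y → + 2 * im (x ⊗ y) ≡ trace x * im y + im x * trace y
  im-⊗ (a +ω b) (c +ω d) = expand a b c d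
    where
    expand : ∀ a b c d → + 2 * (a * d + b * c + b * d) ≡ (+ 2 * a + b) * d + b * (+ 2 * c + d)
    expand = solve-∀

  four-norm : ∀ x → + 4 * norm x ≡ trace x * trace x - (+ 4 * k + + 1) * (im x * im x)
  four-norm (a +ω b) = expand a b k
    where
    expand : ∀ a b k → + 4 * (a * a + a * b - k * (b * b)) ≡ (+ 2 * a + b) * (+ 2 * a + b) - (+ 4 * k + + 1) * (b * b)
    expand = solve-∀

  trace-im-injective : ∀ {x y} → trace x ≡ trace y → im x ≡ im y → x ≡ y
  trace-im-injective {a +ω b} {c +ω d} 2a+b≡2c+b refl = ≡ω (ℤ.*-cancelˡ-≡ (+ 2) a c (begin
    + 2 * a         ≡⟨ i≡i+j-j (+ 2 * a) b ⟩
    + 2 * a + b - b ≡⟨ cong (_- b) 2a+b≡2c+b ⟩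
    + 2 * c + b - b ≡⟨ i≡i+j-j (+ 2 * c) b ⟨
    + 2 * c         ∎)) refl
    where open ≡-Reasoning

  ⊗-cancelˡ : ∀ {c x y} → norm c ≢ + 0 → c ⊗ x ≡ c ⊗ y → x ≡ y
  ⊗-cancelˡ {c} {x} {y} Nc≢0 eq = ι-cancel Nc≢0 (begin
    ι (norm c) ⊗ x       ≡⟨ cong (_⊗ x) (trans (sym (x⊗conj[x]≡ι[norm[x]] c)) (⊗-comm c (conj c))) ⟩
    conj c ⊗ c ⊗ x       ≡⟨ ⊗-assoc (conj c) c x ⟩
    conj c ⊗ (c ⊗ x)     ≡⟨ cong (conj c ⊗_) eq ⟩
    conj c ⊗ (c ⊗ y)     ≡⟨ ⊗-assoc (conj c) c y ⟨
    conj c ⊗ c ⊗ y       ≡⟨ cong (_⊗ y) (trans (⊗-comm (conj c) c) (x⊗conj[x]≡ι[norm[x]] c)) ⟩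
    ι (norm c) ⊗ y       ∎)
    where open ≡-Reasoning

  infix 4 _∣ω_ _∈⟨_,_⟩ _∈⟦_⟧

  _∣ω_ : ℤ[ω] → ℤ[ω] → Set
  γ ∣ω x = ∃[ ρ ] x ≡ γ ⊗ ρ

  _∈⟨_,_⟩ : ℤ[ω] → ℤ[ω] → ℤ[ω] → Set
  x ∈⟨ a , b ⟩ = ∃₂ λ u v → x ≡ u ⊗ a ⊕ v ⊗ b

  Principal₂ : ℤ[ω] → ℤ[ω] → Set
  Principal₂ a b = ∃[ γ ] (γ ∈⟨ a , b ⟩ × γ ∣ω a × γ ∣ω b)

  ∣-refl : ∀ x → x ∣ω x
  ∣-refl x = 1ω , sym (⊗-identityʳ x)

  ∣-trans : ∀ {γ x y} → γ ∣ω x → x ∣ω y → γ ∣ω y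
  ∣-trans {γ} (ρ , refl) (σ , refl) = ρ ⊗ σ , ⊗-assoc γ ρ σ

  ∣-combination : ∀ {γ a b} → γ ∣ω a → γ ∣ω b → ∀ u v → γ ∣ω u ⊗ a ⊕ v ⊗ b
  ∣-combination {γ} (ρ , refl) (σ , refl) u v = u ⊗ ρ ⊕ v ⊗ σ , regroup u v γ ρ σ
    where
    regroup : ∀ u v γ ρ σ → u ⊗ (γ ⊗ ρ) ⊕ v ⊗ (γ ⊗ σ) ≡ γ ⊗ (u ⊗ ρ ⊕ v ⊗ σ)
    regroup = RingSolver.solve-∀ ring

  ∈-combination : ∀ {a b x y} → x ∈⟨ a , b ⟩ → y ∈⟨ a , b ⟩ → ∀ p q → p ⊗ x ⊕ q ⊗ y ∈⟨ a , b ⟩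
  ∈-combination {a} {b} (u , v , refl) (u′ , v′ , refl) p q = p ⊗ u ⊕ q ⊗ u′ , p ⊗ v ⊕ q ⊗ v′ , regroup p q u v u′ v′ a b
    where
    regroup : ∀ p q u v u′ v′ a b → p ⊗ (u ⊗ a ⊕ v ⊗ b) ⊕ q ⊗ (u′ ⊗ a ⊕ v′ ⊗ b)
                                  ≡ (p ⊗ u ⊕ q ⊗ u′) ⊗ a ⊕ (p ⊗ v ⊕ q ⊗ v′) ⊗ b
    regroup = RingSolver.solve-∀ ring

  ∈-resp : ∀ {a b x y} → x ≡ y → x ∈⟨ a , b ⟩ → y ∈⟨ a , b ⟩
  ∈-resp refl x∈ = x∈

  ∈-left : ∀ {a b} → a ∈⟨ a , b ⟩
  ∈-left {a} {b} = 1ω , 0ω , pick a b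
    where
    pick : ∀ a b → a ≡ 1ω ⊗ a ⊕ 0ω ⊗ b
    pick = RingSolver.solve-∀ ring

  ∈-right : ∀ {a b} → b ∈⟨ a , b ⟩
  ∈-right {a} {b} = 0ω , 1ω , pick a b
    where
    pick : ∀ a b → b ≡ 0ω ⊗ a ⊕ 1ω ⊗ b
    pick = RingSolver.solve-∀ ring

  ∈-⊕ : ∀ {a b x y} → x ∈⟨ a , b ⟩ → y ∈⟨ a , b ⟩ → x ⊕ y ∈⟨ a , b ⟩
  ∈-⊕ {x = x} {y} x∈ y∈ = ∈-resp (unit x y) (∈-combination x∈ y∈ 1ω 1ω)
    where
    unit : ∀ x y → 1ω ⊗ x ⊕ 1ω ⊗ y ≡ x ⊕ y
    unit = RingSolver.solve-∀ ring

  ∈-⊗ : ∀ {a b x} t → x ∈⟨ a , b ⟩ → t ⊗ x ∈⟨ a , b ⟩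
  ∈-⊗ {x = x} t x∈ = ∈-resp (drop t x) (∈-combination x∈ x∈ t 0ω)
    where
    drop : ∀ t x → t ⊗ x ⊕ 0ω ⊗ x ≡ t ⊗ x
    drop = RingSolver.solve-∀ ring

  ∈-⊖ : ∀ {a b x} → x ∈⟨ a , b ⟩ → ⊖ x ∈⟨ a , b ⟩
  ∈-⊖ {x = x} x∈ = ∈-resp (negate x) (∈-⊗ (⊖ 1ω) x∈)
    where
    negate : ∀ x → ⊖ 1ω ⊗ x ≡ ⊖ x
    negate = RingSolver.solve-∀ ring

  x≡y⊕z⇒z≡x⊖y : ∀ {x y z} → x ≡ y ⊕ z → z ≡ x ⊕ ⊖ y
  x≡y⊕z⇒z≡x⊖y {y = y} {z} refl = cancel y z
    where
    cancel : ∀ y z → z ≡ y ⊕ z ⊕ ⊖ y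
    cancel = RingSolver.solve-∀ ring

  -- im (s₁ ω n + (s₃ - s₂ + s₂ ω)(u + v ω)) = s₁ n + s₂ u + s₃ v.
  B+ω∈⟨n,u+vω⟩ : ∀ n u v s₁ s₂ s₃ → s₁ * n + s₂ * u + s₃ * v ≡ + 1 → ∃[ B ] B +ω + 1 ∈⟨ ι n , u +ω v ⟩
  B+ω∈⟨n,u+vω⟩ n u v s₁ s₂ s₃ coprime =
    re β , + 0 +ω s₁ , s₃ - s₂ +ω s₂ , cong (re β +ω_) (trans (sym coprime) (expand s₁ s₂ s₃ n u v k))
    where
    β = (+ 0 +ω s₁) ⊗ ι n ⊕ (s₃ - s₂ +ω s₂) ⊗ (u +ω v)
    expand : ∀ s₁ s₂ s₃ n u v k → s₁ * n + s₂ * u + s₃ * v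
           ≡ + 0 * + 0 + s₁ * n + s₁ * + 0 + ((s₃ - s₂) * v + s₂ * u + s₂ * v)
    expand = solve-∀

  Principal₂-resp : ∀ {a b a′ b′} → a ∈⟨ a′ , b′ ⟩ → b ∈⟨ a′ , b′ ⟩ → a′ ∈⟨ a , b ⟩ → b′ ∈⟨ a , b ⟩ →
                    Principal₂ a b → Principal₂ a′ b′
  Principal₂-resp a∈ b∈ (s , t , refl) (s′ , t′ , refl) (γ , (u , v , refl) , γ∣a , γ∣b) =
    γ , ∈-combination a∈ b∈ u v , ∣-combination γ∣a γ∣b s t , ∣-combination γ∣a γ∣b s′ t′

  Principal₂-scale : ∀ {a b} c → Principal₂ a b → Principal₂ (c ⊗ a) (c ⊗ b)
  Principal₂-scale {a} {b} c (γ , (u , v , refl) , (ρ , a≡γρ) , (σ , b≡γσ)) =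
    c ⊗ γ , (u , v , regroup c u v a b) , (ρ , scaled a≡γρ) , (σ , scaled b≡γσ)
    where
    regroup : ∀ c u v a b → c ⊗ (u ⊗ a ⊕ v ⊗ b) ≡ u ⊗ (c ⊗ a) ⊕ v ⊗ (c ⊗ b)
    regroup = RingSolver.solve-∀ ring
    scaled : ∀ {x γ ρ} → x ≡ γ ⊗ ρ → c ⊗ x ≡ c ⊗ γ ⊗ ρ
    scaled {γ = γ} {ρ} x≡γρ = trans (cong (c ⊗_) x≡γρ) (sym (⊗-assoc c γ ρ))

  Principal₂-cancel : ∀ {c a b} → norm c ≢ + 0 → Principal₂ (c ⊗ a) (c ⊗ b) → Principal₂ a b
  Principal₂-cancel {c} {a} {b} Nc≢0 (δ , (u , v , δ≡) , (ρ , ca≡δρ) , (σ , cb≡δσ)) =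
    α , (u , v , refl) , (ρ , ⊗-cancelˡ Nc≢0 (through ca≡δρ)) , (σ , ⊗-cancelˡ Nc≢0 (through cb≡δσ))
    where
    α = u ⊗ a ⊕ v ⊗ b
    regroup : ∀ u v c a b → u ⊗ (c ⊗ a) ⊕ v ⊗ (c ⊗ b) ≡ c ⊗ (u ⊗ a ⊕ v ⊗ b)
    regroup = RingSolver.solve-∀ ring
    through : ∀ {x ρ} → c ⊗ x ≡ δ ⊗ ρ → c ⊗ x ≡ c ⊗ (α ⊗ ρ)
    through {x} {ρ} eq = trans eq (trans (cong (_⊗ ρ) (trans δ≡ (regroup u v c a b))) (⊗-assoc c α ρ))

  Principal₂-swap : ∀ {a b} → Principal₂ a b → Principal₂ b a
  Principal₂-swap {a} {b} (γ , (u , v , γ≡) , γ∣a , γ∣b) = γ , (v , u , trans γ≡ (⊕-comm (u ⊗ a) (v ⊗ b))) , γ∣b , γ∣a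

  Principal₂-⊖ʳ : ∀ {a b} → Principal₂ a b → Principal₂ a (⊖ b)
  Principal₂-⊖ʳ {a} {b} (γ , (u , v , γ≡) , γ∣a , (σ , refl)) =
    γ , (u , ⊖ v , trans γ≡ (cong (u ⊗ a ⊕_) (negate-both v b))) , γ∣a , (⊖ σ , negate-right γ σ)
    where
    negate-both : ∀ x y → x ⊗ y ≡ ⊖ x ⊗ ⊖ y
    negate-both = RingSolver.solve-∀ ring
    negate-right : ∀ x y → ⊖ (x ⊗ y) ≡ x ⊗ ⊖ y
    negate-right = RingSolver.solve-∀ ring

  Principal₂-⊖ˡ : ∀ {a b} → Principal₂ a b → Principal₂ (⊖ a) b
  Principal₂-⊖ˡ = Principal₂-swap ∘ Principal₂-⊖ʳ ∘ Principal₂-swap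

  Principal₂-ι∣a∣ : ∀ {a b} → Principal₂ (ι (+ ∣ a ∣)) b → Principal₂ (ι a) b
  Principal₂-ι∣a∣ {+ n} = λ p → p
  Principal₂-ι∣a∣ { -[1+ n ]} = Principal₂-⊖ˡ

  Principal₂-shift : ∀ {a b} t → Principal₂ a b → Principal₂ a (t ⊗ a ⊕ b)
  Principal₂-shift {a} {b} t =
    Principal₂-resp (1ω , 0ω , first a (t ⊗ a ⊕ b)) (⊖ t , 1ω , unshift t a b) (1ω , 0ω , first a b) (t , 1ω , shift t a b)
    where
    first : ∀ a b → a ≡ 1ω ⊗ a ⊕ 0ω ⊗ b
    first = RingSolver.solve-∀ ring
    shift : ∀ t a b → t ⊗ a ⊕ b ≡ t ⊗ a ⊕ 1ω ⊗ b
    shift = RingSolver.solve-∀ ring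
    unshift : ∀ t a b → b ≡ ⊖ t ⊗ a ⊕ 1ω ⊗ (t ⊗ a ⊕ b)
    unshift = RingSolver.solve-∀ ring

  Principal₂-conj : ∀ {a b} → Principal₂ a b → Principal₂ (conj a) (conj b)
  Principal₂-conj {a} {b} (γ , (u , v , γ≡) , (ρ , a≡γρ) , (σ , b≡γσ)) =
    conj γ , (conj u , conj v , conj-combination γ≡) , (conj ρ , conj-product a≡γρ) , (conj σ , conj-product b≡γσ)
    where
    conj-product : ∀ {x y z} → x ≡ y ⊗ z → conj x ≡ conj y ⊗ conj z
    conj-product {y = y} {z} x≡yz = trans (cong conj x≡yz) (conj-⊗ y z)
    conj-combination : γ ≡ u ⊗ a ⊕ v ⊗ b → conj γ ≡ conj u ⊗ conj a ⊕ conj v ⊗ conj b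
    conj-combination γ≡ = trans (cong conj γ≡) (trans (conj-⊕ (u ⊗ a) (v ⊗ b)) (cong₂ _⊕_ (conj-⊗ u a) (conj-⊗ v b)))

  Principal₂-0ˡ : ∀ b → Principal₂ 0ω b
  Principal₂-0ˡ b = b , (0ω , 1ω , expand b) , (0ω , annihilate b) , ∣-refl b
    where
    expand : ∀ b → b ≡ 0ω ⊗ 0ω ⊕ 1ω ⊗ b
    expand = RingSolver.solve-∀ ring
    annihilate : ∀ b → 0ω ≡ b ⊗ 0ω
    annihilate = RingSolver.solve-∀ ring

  Principal₂-1ˡ : ∀ b → Principal₂ 1ω b
  Principal₂-1ˡ b = 1ω , (1ω , 0ω , expand b) , ∣-refl 1ω , (b , unit b)
    where
    expand : ∀ b → 1ω ≡ 1ω ⊗ 1ω ⊕ 0ω ⊗ b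
    expand = RingSolver.solve-∀ ring
    unit : ∀ b → b ≡ 1ω ⊗ b
    unit = RingSolver.solve-∀ ring

  -- β (c, conj β) = (c β, a c) = c (a, β).
  Principal₂-reduce : ∀ {a c β} → c ≢ + 0 → β ⊗ conj β ≡ ι a ⊗ ι c → Principal₂ (ι c) (conj β) → Principal₂ (ι a) β
  Principal₂-reduce {a} {c} {β} c≢0 ββ̄≡ac =
    Principal₂-cancel Nc≢0 ∘ Principal₂-swap
      ∘ subst₂ Principal₂ (⊗-comm β (ι c)) (trans ββ̄≡ac (⊗-comm (ι a) (ι c))) ∘ Principal₂-scale β
    where
    Nc≢0 : norm (ι c) ≢ + 0
    Nc≢0 Nc≡0 with ℤ.i*j≡0⇒i≡0∨j≡0 c (trans (sym (norm-ι c)) Nc≡0)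
    ... | inj₁ c≡0 = c≢0 c≡0
    ... | inj₂ c≡0 = c≢0 c≡0

  combination : ∀ {n} → Vec ℤ[ω] n → Vec ℤ[ω] n → ℤ[ω]
  combination [] [] = 0ω
  combination (c ∷ cs) (g ∷ gs) = c ⊗ g ⊕ combination cs gs

  _∈⟦_⟧ : ∀ {n} → ℤ[ω] → Vec ℤ[ω] n → Set
  x ∈⟦ gs ⟧ = ∃[ cs ] x ≡ combination cs gs

  PrincipalIdeal : ∀ {n} → Vec ℤ[ω] n → Set
  PrincipalIdeal gs = ∃[ γ ] (∀ x → (x ∈⟦ gs ⟧ → x ∈⟦ γ ∷ [] ⟧) × (x ∈⟦ γ ∷ [] ⟧ → x ∈⟦ gs ⟧))

  combination-scale : ∀ {n} v (cs gs : Vec ℤ[ω] n) → combination (Vec.map (v ⊗_) cs) gs ≡ v ⊗ combination cs gs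
  combination-scale v [] [] = annihilate v
    where
    annihilate : ∀ v → 0ω ≡ v ⊗ 0ω
    annihilate = RingSolver.solve-∀ ring
  combination-scale v (c ∷ cs) (g ∷ gs) = trans (cong (v ⊗ c ⊗ g ⊕_) (combination-scale v cs gs)) (regroup v c g (combination cs gs))
    where
    regroup : ∀ v c g s → v ⊗ c ⊗ g ⊕ v ⊗ s ≡ v ⊗ (c ⊗ g ⊕ s)
    regroup = RingSolver.solve-∀ ring

  ∣-combination-of : ∀ {n γ} {gs : Vec ℤ[ω] n} → All (γ ∣ω_) gs → ∀ cs → γ ∣ω combination cs gs
  ∣-combination-of {γ = γ} [] [] = 0ω , annihilate γ
    where
    annihilate : ∀ γ → 0ω ≡ γ ⊗ 0ω
    annihilate = RingSolver.solve-∀ ring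
  ∣-combination-of {γ = γ} (γ∣g ∷ γ∣gs) (c ∷ cs) with ∣-combination γ∣g (∣-combination-of γ∣gs cs) c 1ω
  ... | t , eq = t , trans (cong (c ⊗ _ ⊕_) (unit (combination cs _))) eq
    where
    unit : ∀ x → x ≡ 1ω ⊗ x
    unit = RingSolver.solve-∀ ring

  common-divisor-in-ideal⇒principal : ∀ {n γ} {gs : Vec ℤ[ω] n} → γ ∈⟦ gs ⟧ → All (γ ∣ω_) gs → PrincipalIdeal gs
  common-divisor-in-ideal⇒principal {γ = γ} {gs} (cs , γ≡) γ∣gs = γ , λ x → to x , from x
    where
    to : ∀ x → x ∈⟦ gs ⟧ → x ∈⟦ γ ∷ [] ⟧
    to x (ds , refl) with ∣-combination-of γ∣gs ds
    ... | t , eq = t ∷ [] , trans eq (trans (⊗-comm γ t) (sym (⊕-identityʳ (t ⊗ γ))))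
    from : ∀ x → x ∈⟦ γ ∷ [] ⟧ → x ∈⟦ gs ⟧
    from x (c ∷ [] , refl) = Vec.map (c ⊗_) cs , trans (⊕-identityʳ (c ⊗ γ)) (trans (cong (c ⊗_) γ≡) (sym (combination-scale c cs gs)))

  principal-pairs⇒principal : (∀ a b → Principal₂ a b) → ∀ {n} (gs : Vec ℤ[ω] n) → PrincipalIdeal gs
  principal-pairs⇒principal principal₂ gs = common-divisor-in-ideal⇒principal (proj₁ (proj₂ (gcd gs))) (proj₂ (proj₂ (gcd gs)))
    where
    gcd : ∀ {n} (gs : Vec ℤ[ω] n) → ∃[ γ ] (γ ∈⟦ gs ⟧ × All (γ ∣ω_) gs)
    gcd [] = 0ω , ([] , refl) , []
    gcd (g ∷ gs) with gcd gs
    ... | γ , (cs , γ≡) , γ∣gs with principal₂ g γ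
    ...   | δ , (u , v , δ≡) , δ∣g , δ∣γ =
      δ , (u ∷ Vec.map (v ⊗_) cs , trans δ≡ (cong (u ⊗ g ⊕_) (trans (cong (v ⊗_) γ≡) (sym (combination-scale v cs gs)))))
        , δ∣g ∷ All.map (∣-trans δ∣γ) γ∣gs

  principal⇒Principal₂ : ∀ {a b} → PrincipalIdeal (a ∷ b ∷ []) → Principal₂ a b
  principal⇒Principal₂ {a} {b} (γ , same) =
    γ , γ∈ , γ∣ a (1ω ∷ 0ω ∷ [] , pick-first a b) , γ∣ b (0ω ∷ 1ω ∷ [] , pick-second a b)
    where
    pick-first : ∀ a b → a ≡ 1ω ⊗ a ⊕ (0ω ⊗ b ⊕ 0ω)
    pick-first = RingSolver.solve-∀ ring
    pick-second : ∀ a b → b ≡ 0ω ⊗ a ⊕ (1ω ⊗ b ⊕ 0ω)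
    pick-second = RingSolver.solve-∀ ring
    unit : ∀ γ → γ ≡ 1ω ⊗ γ ⊕ 0ω
    unit = RingSolver.solve-∀ ring
    γ∣ : ∀ x → x ∈⟦ a ∷ b ∷ [] ⟧ → γ ∣ω x
    γ∣ x x∈ with proj₁ (same x) x∈
    ... | t ∷ [] , x≡ = t , trans x≡ (trans (⊕-identityʳ (t ⊗ γ)) (⊗-comm t γ))
    γ∈ : γ ∈⟨ a , b ⟩
    γ∈ with proj₂ (same γ) (1ω ∷ [] , unit γ)
    ... | u ∷ v ∷ [] , eq = u , v , trans eq (cong (u ⊗ a ⊕_) (⊕-identityʳ (v ⊗ b)))

  -- 3 ∣ N γ because N(3u + vg) ≡ N v N g (mod 3); writing N γ = 3A, the equation 3 = γ ρ gives
  -- conj γ = A ρ, so A divides im (conj g) = -1.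
  generator-of-⟨3,g⟩ : ∀ {g} → (∃[ h ] norm g ≡ + 3 * h) → im g ≡ + 1 → Principal₂ (ι (+ 3)) g →
                       ∃[ γ ] (norm γ ≡ + 3 ⊎ norm γ ≡ - + 3)
  generator-of-⟨3,g⟩ {g} (h , Ng≡3h) im[g]≡1 (γ , (u , v , refl) , (ρ , 3≡γρ) , (σ , g≡γσ)) = γ , by-unit A ∣A∣≡1 Nγ≡3A
    where
    A = + 3 * norm u + norm v * h + trace (u ⊗ conj (v ⊗ g))
    Nγ≡3A : norm γ ≡ + 3 * A
    Nγ≡3A = begin
      norm (u ⊗ ι (+ 3) ⊕ v ⊗ g)
        ≡⟨ norm-⊕ (u ⊗ ι (+ 3)) (v ⊗ g) ⟩
      norm (u ⊗ ι (+ 3)) + norm (v ⊗ g) + trace (u ⊗ ι (+ 3) ⊗ conj (v ⊗ g))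
        ≡⟨ cong₂ (λ x y → x + y + trace (u ⊗ ι (+ 3) ⊗ conj (v ⊗ g))) (trans (norm-⊗ u (ι (+ 3))) (cong (norm u *_) (norm-ι (+ 3))))
                                                                          (trans (norm-⊗ v g) (cong (norm v *_) Ng≡3h)) ⟩
      norm u * + 9 + norm v * (+ 3 * h) + trace (u ⊗ ι (+ 3) ⊗ conj (v ⊗ g))
        ≡⟨ cong (λ x → norm u * + 9 + norm v * (+ 3 * h) + trace x) (pull-out u (ι (+ 3)) (conj (v ⊗ g))) ⟩
      norm u * + 9 + norm v * (+ 3 * h) + trace (ι (+ 3) ⊗ (u ⊗ conj (v ⊗ g)))
        ≡⟨ cong (_+_ (norm u * + 9 + norm v * (+ 3 * h))) (trace-ι⊗ (+ 3) (u ⊗ conj (v ⊗ g))) ⟩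
      norm u * + 9 + norm v * (+ 3 * h) + + 3 * trace (u ⊗ conj (v ⊗ g))
        ≡⟨ factor (norm u) (norm v) h (trace (u ⊗ conj (v ⊗ g))) ⟩
      + 3 * A ∎
      where
      open ≡-Reasoning
      pull-out : ∀ u c w → u ⊗ c ⊗ w ≡ c ⊗ (u ⊗ w)
      pull-out = RingSolver.solve-∀ ring
      factor : ∀ Nu Nv h T → Nu * + 9 + Nv * (+ 3 * h) + + 3 * T ≡ + 3 * (+ 3 * Nu + Nv * h + T)
      factor = solve-∀
    conj[γ]≡Aρ : conj γ ≡ ι A ⊗ ρ
    conj[γ]≡Aρ = ι-cancel {+ 3} (λ ()) (begin
      ι (+ 3) ⊗ conj γ         ≡⟨ cong (_⊗ conj γ) 3≡γρ ⟩
      γ ⊗ ρ ⊗ conj γ           ≡⟨ swap γ ρ (conj γ) ⟩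
      γ ⊗ conj γ ⊗ ρ           ≡⟨ cong (_⊗ ρ) (trans (x⊗conj[x]≡ι[norm[x]] γ) (trans (cong ι Nγ≡3A) (ι-* (+ 3) A))) ⟩
      ι (+ 3) ⊗ ι A ⊗ ρ        ≡⟨ ⊗-assoc (ι (+ 3)) (ι A) ρ ⟩
      ι (+ 3) ⊗ (ι A ⊗ ρ)      ∎)
      where
      open ≡-Reasoning
      swap : ∀ x y z → x ⊗ y ⊗ z ≡ x ⊗ z ⊗ y
      swap = RingSolver.solve-∀ ring
    A∣im[conj[g]] : A * im (ρ ⊗ conj σ) ≡ - + 1
    A∣im[conj[g]] = begin
      A * im (ρ ⊗ conj σ)       ≡⟨ im-ι⊗ A (ρ ⊗ conj σ) ⟨
      im (ι A ⊗ (ρ ⊗ conj σ))   ≡⟨ cong im (⊗-assoc (ι A) ρ (conj σ)) ⟨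
      im (ι A ⊗ ρ ⊗ conj σ)     ≡⟨ cong (λ x → im (x ⊗ conj σ)) conj[γ]≡Aρ ⟨
      im (conj γ ⊗ conj σ)      ≡⟨ cong im (trans (cong conj g≡γσ) (conj-⊗ γ σ)) ⟨
      im (conj g)               ≡⟨ trans (im-conj g) (cong -_ im[g]≡1) ⟩
      - + 1                     ∎
      where open ≡-Reasoning
    ∣A∣≡1 : ∣ A ∣ ≡ 1
    ∣A∣≡1 = ℕ.m*n≡1⇒m≡1 ∣ A ∣ _ (trans (sym (ℤ.abs-* A _)) (cong ∣_∣ A∣im[conj[g]]))
    by-unit : ∀ B → ∣ B ∣ ≡ 1 → norm γ ≡ + 3 * B → norm γ ≡ + 3 ⊎ norm γ ≡ - + 3
    by-unit (+ 1) _ Nγ≡3 = inj₁ Nγ≡3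
    by-unit -[1+ 0 ] _ Nγ≡-3 = inj₂ Nγ≡-3
    by-unit (+ 0) ()
    by-unit (+ suc (suc _)) ()
    by-unit -[1+ suc _ ] ()

-- Ideals of OK (4k + 1) are ideals of ℤ[ω]

module Transfer (k : ℤ) where
  open QuadraticIntegers k

  -- An element (x + y √d)/2 of OK d is x' + y ω with x = 2 x' + y, since ω = (1 + √d)/2.
  φ : OK (+ 4 * k + + 1) → ℤ[ω]
  φ z = proj₁ (4∣x²-dy²⇒x≡y[mod2] k (OK.x z) (OK.y z) (OK.integral z)) +ω OK.y z

  trace-φ : ∀ z → trace (φ z) ≡ OK.x z
  trace-φ z = sym (proj₂ (4∣x²-dy²⇒x≡y[mod2] k (OK.x z) (OK.y z) (OK.integral z)))

  ψ : ℤ[ω] → OK (+ 4 * k + + 1)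
  ψ z = mkOK (trace z) (im z) (∣⇒∣ᵤ (divides (norm z) (trans (sym (four-norm z)) (ℤ.*-comm (+ 4) (norm z)))))

  φψ : ∀ z → φ (ψ z) ≡ z
  φψ z = trace-im-injective (trace-φ (ψ z)) refl

  map-φψ : ∀ {n} (zs : Vec ℤ[ω] n) → Vec.map φ (Vec.map ψ zs) ≡ zs
  map-φψ [] = refl
  map-φψ (z ∷ zs) = cong₂ _∷_ (φψ z) (map-φψ zs)

  combinationᴼ : ∀ {n} → Vec (OK (+ 4 * k + + 1)) n → Vec (OK (+ 4 * k + + 1)) n → ℤ[ω]
  combinationᴼ rs gs = combination (Vec.map φ rs) (Vec.map φ gs)

  sumRe≡2trace : ∀ {n} (rs gs : Vec (OK (+ 4 * k + + 1)) n) → sumRe rs gs ≡ + 2 * trace (combinationᴼ rs gs)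
  sumRe≡2trace [] [] = refl
  sumRe≡2trace (r ∷ rs) (g ∷ gs) = begin
    OK.x r * OK.x g + (+ 4 * k + + 1) * (OK.y r * OK.y g) + sumRe rs gs
      ≡⟨ cong₂ (λ s t → s * t + (+ 4 * k + + 1) * (OK.y r * OK.y g) + sumRe rs gs) (trace-φ r) (trace-φ g) ⟨
    trace (φ r) * trace (φ g) + (+ 4 * k + + 1) * (im (φ r) * im (φ g)) + sumRe rs gs
      ≡⟨ cong₂ _+_ (trace-⊗ (φ r) (φ g)) (sym (sumRe≡2trace rs gs)) ⟨
    + 2 * trace (φ r ⊗ φ g) + + 2 * trace (combinationᴼ rs gs)
      ≡⟨ ℤ.*-distribˡ-+ (+ 2) (trace (φ r ⊗ φ g)) (trace (combinationᴼ rs gs)) ⟨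
    + 2 * (trace (φ r ⊗ φ g) + trace (combinationᴼ rs gs))
      ≡⟨ cong (+ 2 *_) (trace-⊕ (φ r ⊗ φ g) (combinationᴼ rs gs)) ⟨
    + 2 * trace (combinationᴼ (r ∷ rs) (g ∷ gs)) ∎
    where open ≡-Reasoning

  sumIm≡2im : ∀ {n} (rs gs : Vec (OK (+ 4 * k + + 1)) n) → sumIm rs gs ≡ + 2 * im (combinationᴼ rs gs)
  sumIm≡2im [] [] = refl
  sumIm≡2im (r ∷ rs) (g ∷ gs) = begin
    OK.x r * OK.y g + OK.y r * OK.x g + sumIm rs gs
      ≡⟨ cong₂ (λ s t → s * OK.y g + OK.y r * t + sumIm rs gs) (trace-φ r) (trace-φ g) ⟨
    trace (φ r) * im (φ g) + im (φ r) * trace (φ g) + sumIm rs gs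
      ≡⟨ cong₂ _+_ (im-⊗ (φ r) (φ g)) (sym (sumIm≡2im rs gs)) ⟨
    + 2 * im (φ r ⊗ φ g) + + 2 * im (combinationᴼ rs gs)
      ≡⟨ ℤ.*-distribˡ-+ (+ 2) (im (φ r ⊗ φ g)) (im (combinationᴼ rs gs)) ⟨
    + 2 * (im (φ r ⊗ φ g) + im (combinationᴼ rs gs))
      ≡⟨ cong (+ 2 *_) (im-⊕ (φ r ⊗ φ g) (combinationᴼ rs gs)) ⟨
    + 2 * im (combinationᴼ (r ∷ rs) (g ∷ gs)) ∎
    where open ≡-Reasoning

  InIdeal⇒∈ : ∀ {n} (gs : Vec (OK (+ 4 * k + + 1)) n) z → InIdeal gs z → φ z ∈⟦ Vec.map φ gs ⟧
  InIdeal⇒∈ gs z (rs , 2x≡ , 2y≡) = Vec.map φ rs , trace-im-injective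
    (trans (trace-φ z) (ℤ.*-cancelˡ-≡ (+ 2) _ _ (trans 2x≡ (sumRe≡2trace rs gs))))
    (ℤ.*-cancelˡ-≡ (+ 2) _ _ (trans 2y≡ (sumIm≡2im rs gs)))

  ∈⇒InIdeal : ∀ {n} (gs : Vec (OK (+ 4 * k + + 1)) n) z → φ z ∈⟦ Vec.map φ gs ⟧ → InIdeal gs z
  ∈⇒InIdeal gs z (cs , φz≡) = Vec.map ψ cs , 2x≡ , 2y≡
    where
    φz≡′ : φ z ≡ combinationᴼ (Vec.map ψ cs) gs
    φz≡′ = trans φz≡ (cong (λ cs → combination cs (Vec.map φ gs)) (sym (map-φψ cs)))
    2x≡ = trans (cong (+ 2 *_) (trans (sym (trace-φ z)) (cong trace φz≡′))) (sym (sumRe≡2trace (Vec.map ψ cs) gs))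
    2y≡ = trans (cong (+ 2 *_) (cong im φz≡′)) (sym (sumIm≡2im (Vec.map ψ cs) gs))

  classNumberOne⇒principal : ClassNumberOne (+ 4 * k + + 1) → ∀ {n} (gs : Vec ℤ[ω] n) → PrincipalIdeal gs
  classNumberOne⇒principal cn {n} gs = φ α , λ x → to x , from x
    where
    α = proj₁ (cn n (Vec.map ψ gs))
    same = proj₂ (cn n (Vec.map ψ gs))
    pull : ∀ {n} {x} (hs : Vec ℤ[ω] n) → x ∈⟦ hs ⟧ → φ (ψ x) ∈⟦ Vec.map φ (Vec.map ψ hs) ⟧
    pull {x = x} hs = subst₂ _∈⟦_⟧ (sym (φψ x)) (sym (map-φψ hs))
    to : ∀ x → x ∈⟦ gs ⟧ → x ∈⟦ φ α ∷ [] ⟧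
    to x x∈ = subst (_∈⟦ φ α ∷ [] ⟧) (φψ x)
      (InIdeal⇒∈ (α ∷ []) (ψ x) (proj₁ (same (ψ x)) (∈⇒InIdeal (Vec.map ψ gs) (ψ x) (pull gs x∈))))
    from : ∀ x → x ∈⟦ φ α ∷ [] ⟧ → x ∈⟦ gs ⟧
    from x x∈ = subst₂ _∈⟦_⟧ (φψ x) (map-φψ gs)
      (InIdeal⇒∈ (Vec.map ψ gs) (ψ x) (proj₂ (same (ψ x)) (∈⇒InIdeal (α ∷ []) (ψ x) (subst (_∈⟦ φ α ∷ [] ⟧) (sym (φψ x)) x∈))))

  principal⇒classNumberOne : (∀ {n} (gs : Vec ℤ[ω] n) → PrincipalIdeal gs) → ClassNumberOne (+ 4 * k + + 1)
  principal⇒classNumberOne principal n gs = ψ γ , λ z → to z , from z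
    where
    γ = proj₁ (principal (Vec.map φ gs))
    same = proj₂ (principal (Vec.map φ gs))
    to : ∀ z → InIdeal gs z → InIdeal (ψ γ ∷ []) z
    to z z∈ = ∈⇒InIdeal (ψ γ ∷ []) z (subst (λ γ → φ z ∈⟦ γ ∷ [] ⟧) (sym (φψ γ)) (proj₁ (same (φ z)) (InIdeal⇒∈ gs z z∈)))
    from : ∀ z → InIdeal (ψ γ ∷ []) z → InIdeal gs z
    from z z∈ = ∈⇒InIdeal gs z (proj₂ (same (φ z)) (subst (λ γ → φ z ∈⟦ γ ∷ [] ⟧) (φψ γ) (InIdeal⇒∈ (ψ γ ∷ []) z z∈)))

-- Reduction of ideals

module Anisotropy {p D′ : ℕ} (p-prime : Prime p) (p∤D′ : ¬ p ℕ.∣ D′) where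

  private
    p∣x²⇒p∣x : ∀ {x} → p ℕ.∣ x ℕ.* x → p ℕ.∣ x
    p∣x²⇒p∣x {x} p∣x² with euclidsLemma x x p-prime p∣x²
    ... | inj₁ p∣x = p∣x
    ... | inj₂ p∣x = p∣x

  -- Infinite descent: p divides x and then y, and (x/p, y/p) is again a solution.
  x²≡pD′y²⇒y≡0 : ∀ y x → x ℕ.* x ≡ p ℕ.* D′ ℕ.* (y ℕ.* y) → y ≡ 0
  x²≡pD′y²⇒y≡0 y = descent y (<-wellFounded y)
    where
    instance
      p≢0 : ℕ.NonZero p
      p≢0 = prime⇒nonZero p-prime
    regroup₁ : ∀ p D′ z → p ℕ.* D′ ℕ.* z ≡ D′ ℕ.* z ℕ.* p
    regroup₁ = ℕSolver.solve-∀
    regroup₂ : ∀ x₁ p → p ℕ.* (x₁ ℕ.* x₁ ℕ.* p) ≡ x₁ ℕ.* p ℕ.* (x₁ ℕ.* p)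
    regroup₂ = ℕSolver.solve-∀
    regroup₃ : ∀ p D′ y₁ x₁ → x₁ ℕ.* x₁ ℕ.* p ≡ D′ ℕ.* (y₁ ℕ.* p ℕ.* (y₁ ℕ.* p)) →
               p ℕ.* (x₁ ℕ.* x₁) ≡ p ℕ.* (p ℕ.* D′ ℕ.* (y₁ ℕ.* y₁))
    regroup₃ p D′ y₁ x₁ eq = trans (ℕ.*-comm p (x₁ ℕ.* x₁)) (trans eq (expand p D′ y₁))
      where
      expand : ∀ p D′ y₁ → D′ ℕ.* (y₁ ℕ.* p ℕ.* (y₁ ℕ.* p)) ≡ p ℕ.* (p ℕ.* D′ ℕ.* (y₁ ℕ.* y₁))
      expand = ℕSolver.solve-∀
    descent : ∀ y → Acc ℕ._<_ y → ∀ x → x ℕ.* x ≡ p ℕ.* D′ ℕ.* (y ℕ.* y) → y ≡ 0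
    descent y (acc rec) x x²≡pD′y² with p∣x²⇒p∣x {x} (ℕ.divides (D′ ℕ.* (y ℕ.* y)) (trans x²≡pD′y² (regroup₁ p D′ (y ℕ.* y))))
    ... | ℕ.divides x₁ refl
      with x₁²p≡D′y² ← ℕ.*-cancelˡ-≡ _ _ p (trans (regroup₂ x₁ p) (trans x²≡pD′y² (ℕ.*-assoc p D′ (y ℕ.* y))))
      with euclidsLemma D′ (y ℕ.* y) p-prime (ℕ.divides (x₁ ℕ.* x₁) (sym x₁²p≡D′y²))
    ...   | inj₁ p∣D′ = ⊥-elim (p∤D′ p∣D′)
    ...   | inj₂ p∣y² with p∣x²⇒p∣x {y} p∣y²
    ...     | ℕ.divides zero y≡0 = y≡0
    ...     | ℕ.divides y₁@(suc _) refl =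
      ⊥-elim (ℕ.1+n≢0 (descent y₁ (rec (ℕ.m<m*n y₁ p (ℕ.nonTrivial⇒n>1 p {{prime⇒nonTrivial p-prime}}))) x₁
                            (ℕ.*-cancelˡ-≡ _ _ p (regroup₃ p D′ y₁ x₁ x₁²p≡D′y²))))

  module _ (k : ℕ) (4k+1≡pD′ : 4 ℕ.* k ℕ.+ 1 ≡ p ℕ.* D′) where
    open QuadraticIntegers (+ k)

    norm≡0⇒≡0ω : ∀ x → norm x ≡ + 0 → x ≡ 0ω
    norm≡0⇒≡0ω x Nx≡0 = trace-im-injective trace≡0 im≡0
      where
      D≡pD′ : + 4 * + k + + 1 ≡ + (p ℕ.* D′)
      D≡pD′ = trans (cong (_+ + 1) (sym (ℤ.pos-* 4 k))) (trans (sym (ℤ.pos-+ (4 ℕ.* k) 1)) (cong +_ 4k+1≡pD′))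
      t²≡Db² : trace x * trace x ≡ + (p ℕ.* D′) * (im x * im x)
      t²≡Db² = trans (ℤ.i-j≡0⇒i≡j _ _ (trans (sym (four-norm x)) (cong (+ 4 *_) Nx≡0))) (cong (_* (im x * im x)) D≡pD′)
      ∣t∣²≡pD′∣b∣² : ∣ trace x ∣ ℕ.* ∣ trace x ∣ ≡ p ℕ.* D′ ℕ.* (∣ im x ∣ ℕ.* ∣ im x ∣)
      ∣t∣²≡pD′∣b∣² = trans (sym (ℤ.abs-* (trace x) (trace x)))
                     (trans (cong ∣_∣ t²≡Db²) (trans (ℤ.abs-* (+ (p ℕ.* D′)) (im x * im x)) (cong (p ℕ.* D′ ℕ.*_) (ℤ.abs-* (im x) (im x)))))
      im≡0 : im x ≡ im 0ω
      im≡0 = ℤ.∣i∣≡0⇒i≡0 (x²≡pD′y²⇒y≡0 ∣ im x ∣ ∣ trace x ∣ ∣t∣²≡pD′∣b∣²)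
      trace≡0 : trace x ≡ trace 0ω
      trace≡0 with ℤ.i*j≡0⇒i≡0∨j≡0 (trace x)
                     (trans t²≡Db² (trans (cong (λ b → + (p ℕ.* D′) * (b * b)) im≡0) (ℤ.*-zeroʳ (+ (p ℕ.* D′)))))
      ... | inj₁ t≡0 = t≡0
      ... | inj₂ t≡0 = t≡0

module Reduction (k : ℕ) where
  open QuadraticIntegers (+ k)

  4N+D≡[2B+1]² : ∀ B → + 4 * norm (B +ω + 1) + + (4 ℕ.* k ℕ.+ 1) ≡ + (∣ + 2 * B + + 1 ∣ ℕ.* ∣ + 2 * B + + 1 ∣)
  4N+D≡[2B+1]² B = begin
    + 4 * norm (B +ω + 1) + + (4 ℕ.* k ℕ.+ 1)
      ≡⟨ cong (_+_ (+ 4 * norm (B +ω + 1))) (trans (ℤ.pos-+ (4 ℕ.* k) 1) (cong (_+ + 1) (ℤ.pos-* 4 k))) ⟩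
    + 4 * norm (B +ω + 1) + (+ 4 * + k + + 1)        ≡⟨ complete-square B (+ k) ⟩
    (+ 2 * B + + 1) * (+ 2 * B + + 1)                ≡⟨ +∣i∣*+∣i∣≡i*i (+ 2 * B + + 1) ⟨
    + ∣ + 2 * B + + 1 ∣ * + ∣ + 2 * B + + 1 ∣        ≡⟨ ℤ.pos-* ∣ + 2 * B + + 1 ∣ ∣ + 2 * B + + 1 ∣ ⟨
    + (∣ + 2 * B + + 1 ∣ ℕ.* ∣ + 2 * B + + 1 ∣)      ∎
    where
    open ≡-Reasoning
    complete-square : ∀ B k → + 4 * (B * B + B * + 1 - k * (+ 1 * + 1)) + (+ 4 * k + + 1) ≡ (+ 2 * B + + 1) * (+ 2 * B + + 1)
    complete-square = solve-∀

  reduced-bound : ∀ a B c → a * c ≡ norm (B +ω + 1) → ∣ + 2 * B + + 1 ∣ ℕ.≤ ∣ a ∣ → ∣ a ∣ ℕ.≤ ∣ c ∣ →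
                  4 ℕ.* (∣ a ∣ ℕ.* ∣ a ∣) ℕ.≤ 4 ℕ.* k ℕ.+ 1
  reduced-bound a B c ac≡N e≤a a≤c = by-sign (a * c) refl
    where
    E = ∣ + 2 * B + + 1 ∣
    E²≤∣ac∣ : E ℕ.* E ℕ.≤ ∣ a * c ∣
    E²≤∣ac∣ = ℕ.≤-trans (ℕ.*-mono-≤ e≤a e≤a) (ℕ.≤-trans (ℕ.*-monoʳ-≤ ∣ a ∣ a≤c) (ℕ.≤-reflexive (sym (ℤ.abs-* a c))))
    4ac+D≡E² : + 4 * (a * c) + + (4 ℕ.* k ℕ.+ 1) ≡ + (E ℕ.* E)
    4ac+D≡E² = trans (cong (λ n → + 4 * n + + (4 ℕ.* k ℕ.+ 1)) ac≡N) (4N+D≡[2B+1]² B)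
    by-sign : ∀ n → a * c ≡ n → 4 ℕ.* (∣ a ∣ ℕ.* ∣ a ∣) ℕ.≤ 4 ℕ.* k ℕ.+ 1
    by-sign (+ n) ac≡n = ⊥-elim (ℕ.m+1+n≰m (4 ℕ.* n) (begin
      4 ℕ.* n ℕ.+ suc (4 ℕ.* k)   ≡⟨ cong (4 ℕ.* n ℕ.+_) (ℕ.+-comm 1 (4 ℕ.* k)) ⟩
      4 ℕ.* n ℕ.+ (4 ℕ.* k ℕ.+ 1) ≡⟨ ℤ.+-injective (trans (ℤ.pos-+ (4 ℕ.* n) _)
                                       (trans (cong (_+ _) (trans (ℤ.pos-* 4 n) (cong (+ 4 *_) (sym ac≡n)))) 4ac+D≡E²)) ⟩
      E ℕ.* E                     ≤⟨ E²≤∣ac∣ ⟩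
      ∣ a * c ∣                   ≡⟨ cong ∣_∣ ac≡n ⟩
      n                           ≤⟨ ℕ.m≤n*m n 4 ⟩
      4 ℕ.* n                     ∎))
      where open ℕ.≤-Reasoning
    by-sign -[1+ n ] ac≡n = begin
      4 ℕ.* (∣ a ∣ ℕ.* ∣ a ∣)       ≤⟨ ℕ.*-monoʳ-≤ 4 (ℕ.*-monoʳ-≤ ∣ a ∣ a≤c) ⟩
      4 ℕ.* (∣ a ∣ ℕ.* ∣ c ∣)       ≡⟨ cong (4 ℕ.*_) (trans (sym (ℤ.abs-* a c)) (cong ∣_∣ ac≡n)) ⟩
      4 ℕ.* suc n                 ≤⟨ ℕ.m≤n+m _ (E ℕ.* E) ⟩
      E ℕ.* E ℕ.+ 4 ℕ.* suc n     ≡⟨ ℤ.+-injective D≡ ⟩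
      4 ℕ.* k ℕ.+ 1               ∎
      where
      open ℕ.≤-Reasoning
      cancel : ∀ m d → + 4 * - m + d + + 4 * m ≡ d
      cancel = solve-∀
      D≡ : + (E ℕ.* E ℕ.+ 4 ℕ.* suc n) ≡ + (4 ℕ.* k ℕ.+ 1)
      D≡ = trans (ℤ.pos-+ (E ℕ.* E) _) (trans (cong₂ _+_ (sym 4ac+D≡E²) (ℤ.pos-* 4 (suc n)))
             (trans (cong (λ m → + 4 * m + _ + _) ac≡n) (cancel (+ suc n) _)))

  -- B ↦ -B - 1 is the symmetry of the norm form of B + ω induced by conjugation.
  flip : ℤ → ℤ
  flip B = - B - + 1

  norm-flip : ∀ B → norm (flip B +ω + 1) ≡ norm (B +ω + 1)
  norm-flip B = expand B (+ k)
    where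
    expand : ∀ B k → (- B - + 1) * (- B - + 1) + (- B - + 1) * + 1 - k * (+ 1 * + 1) ≡ B * B + B * + 1 - k * (+ 1 * + 1)
    expand = solve-∀

  conj≡⊖flip : ∀ B → conj (B +ω + 1) ≡ ⊖ (flip B +ω + 1)
  conj≡⊖flip B = ≡ω (negate B) refl
    where
    negate : ∀ B → B + + 1 ≡ - (- B - + 1)
    negate = solve-∀

  ∣2flip+1∣ : ∀ B → ∣ + 2 * flip B + + 1 ∣ ≡ ∣ + 2 * B + + 1 ∣
  ∣2flip+1∣ B = trans (cong ∣_∣ (negate B)) (ℤ.∣-i∣≡∣i∣ (+ 2 * B + + 1))
    where
    negate : ∀ B → + 2 * (- B - + 1) + + 1 ≡ - (+ 2 * B + + 1)
    negate = solve-∀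

  ∣2n+1∣ : ∀ n → ∣ + 2 * + n + + 1 ∣ ≡ suc (2 ℕ.* n)
  ∣2n+1∣ n = cong ∣_∣ (trans (cong (_+ + 1) (sym (ℤ.pos-* 2 n))) (trans (sym (ℤ.pos-+ (2 ℕ.* n) 1)) (cong +_ (ℕ.+-comm (2 ℕ.* n) 1))))

  r+aq+ω≡ : ∀ a q r → r + a * q +ω + 1 ≡ ι q ⊗ ι a ⊕ (r +ω + 1)
  r+aq+ω≡ a q r = ≡ω (expand-re r a q (+ k)) (expand-im q a)
    where
    expand-re : ∀ r a q k → r + a * q ≡ q * a + + 0 * + 0 * k + r
    expand-re = solve-∀
    expand-im : ∀ q a → + 1 ≡ q * + 0 + + 0 * a + + 0 * + 0 + + 1
    expand-im = solve-∀

  norm-shift : ∀ a q r c → a * c ≡ norm (r + a * q +ω + 1) → a * (c - q * (+ 2 * r + a * q + + 1)) ≡ norm (r +ω + 1)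
  norm-shift a q r c ac≡N = begin
    a * (c - q * (+ 2 * r + a * q + + 1))                       ≡⟨ distribute a c q (+ 2 * r + a * q + + 1) ⟩
    a * c - a * (q * (+ 2 * r + a * q + + 1))                   ≡⟨ cong (_- a * (q * (+ 2 * r + a * q + + 1))) ac≡N ⟩
    norm (r + a * q +ω + 1) - a * (q * (+ 2 * r + a * q + + 1)) ≡⟨ expand r a q (+ k) ⟩
    norm (r +ω + 1)                                             ∎
    where
    open ≡-Reasoning
    distribute : ∀ a c q w → a * (c - q * w) ≡ a * c - a * (q * w)
    distribute = solve-∀
    expand : ∀ r a q k → (r + a * q) * (r + a * q) + (r + a * q) * + 1 - k * (+ 1 * + 1) - a * (q * (+ 2 * r + a * q + + 1))
                       ≡ r * r + r * + 1 - k * (+ 1 * + 1)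
    expand = solve-∀

  -- By the symmetries a ↦ -a and B ↦ -B - 1 it suffices to know the reduced ideals (a, B + ω)
  -- with 0 ≤ 2B < a, and then 4a² ≤ D.
  module _ (anisotropic : ∀ x → norm x ≡ + 0 → x ≡ 0ω)
           (reduced-principal : ∀ a B → 4 ℕ.* (a ℕ.* a) ℕ.≤ 4 ℕ.* k ℕ.+ 1 → 2 ℕ.* B ℕ.< a →
                                + a ∣ norm (+ B +ω + 1) → Principal₂ (ι (+ a)) (+ B +ω + 1)) where

    reduced⇒Principal₂ : ∀ a B c → a * c ≡ norm (B +ω + 1) → ∣ + 2 * B + + 1 ∣ ℕ.≤ ∣ a ∣ → ∣ a ∣ ℕ.≤ ∣ c ∣ →
                   Principal₂ (ι a) (B +ω + 1)
    reduced⇒Principal₂ a B c ac≡N e≤a a≤c = Principal₂-ι∣a∣ (by-sign B ac≡N e≤a)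
      where
      bound = reduced-bound a B c ac≡N e≤a a≤c
      ∣a∣∣N : ∀ {B} → a * c ≡ norm (B +ω + 1) → + ∣ a ∣ ∣ norm (B +ω + 1)
      ∣a∣∣N ac≡N = ℕ.divides ∣ c ∣ (trans (cong ∣_∣ (sym ac≡N)) (trans (ℤ.abs-* a c) (ℕ.*-comm ∣ a ∣ ∣ c ∣)))
      by-sign : ∀ B → a * c ≡ norm (B +ω + 1) → ∣ + 2 * B + + 1 ∣ ℕ.≤ ∣ a ∣ → Principal₂ (ι (+ ∣ a ∣)) (B +ω + 1)
      by-sign (+ n) ac≡N e≤a = reduced-principal ∣ a ∣ n bound (subst (ℕ._≤ ∣ a ∣) (∣2n+1∣ n) e≤a) (∣a∣∣N {+ n} ac≡N)
      by-sign -[1+ n ] ac≡N e≤a =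
        subst₂ Principal₂ (conj-ι (+ ∣ a ∣)) (conj-involutive (-[1+ n ] +ω + 1)) (Principal₂-conj
          (subst (Principal₂ (ι (+ ∣ a ∣))) (sym (conj≡⊖flip -[1+ n ])) (Principal₂-⊖ʳ
            (reduced-principal ∣ a ∣ n bound (subst (ℕ._≤ ∣ a ∣) (trans (sym (∣2flip+1∣ -[1+ n ])) (∣2n+1∣ n)) e≤a)
                                             (∣a∣∣N {+ n} (trans ac≡N (sym (norm-flip -[1+ n ]))))))))

    primitive-principal : ∀ a B c → a ≢ + 0 → a * c ≡ norm (B +ω + 1) → Principal₂ (ι a) (B +ω + 1)
    primitive-principal a = go a (<-wellFounded ∣ a ∣)
      where
      go : ∀ a → Acc ℕ._<_ ∣ a ∣ → ∀ B c → a ≢ + 0 → a * c ≡ norm (B +ω + 1) → Principal₂ (ι a) (B +ω + 1)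
      go a (acc rec) B c a≢0 ac≡N with symmetricResidue a B a≢0
      ... | record { q = q ; r = r ; B≡r+aq = B≡r+aq ; ∣2r+1∣≤∣a∣ = ∣2r+1∣≤∣a∣ } =
        subst (λ B → Principal₂ (ι a) (B +ω + 1)) (sym B≡r+aq)
          (subst (Principal₂ (ι a)) (sym (r+aq+ω≡ a q r)) (Principal₂-shift (ι q) at-r))
        where
        c′ = c - q * (+ 2 * r + a * q + + 1)
        ac′≡N : a * c′ ≡ norm (r +ω + 1)
        ac′≡N = norm-shift a q r c (trans ac≡N (cong (λ B → norm (B +ω + 1)) B≡r+aq))
        c′≢0 : c′ ≢ + 0
        c′≢0 c′≡0 with cong im (anisotropic (r +ω + 1) (trans (sym ac′≡N) (trans (cong (a *_) c′≡0) (ℤ.*-zeroʳ a))))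
        ... | ()
        at-r : Principal₂ (ι a) (r +ω + 1)
        at-r with ∣ c′ ∣ ℕ.<? ∣ a ∣
        ... | yes c′<a = Principal₂-reduce c′≢0 ββ̄≡ac′
                           (subst (Principal₂ (ι c′)) (sym (conj≡⊖flip r)) (Principal₂-⊖ʳ
                             (go c′ (rec c′<a) (flip r) a c′≢0 (trans (ℤ.*-comm c′ a) (trans ac′≡N (sym (norm-flip r)))))))
          where
          ββ̄≡ac′ : (r +ω + 1) ⊗ conj (r +ω + 1) ≡ ι a ⊗ ι c′
          ββ̄≡ac′ = trans (x⊗conj[x]≡ι[norm[x]] (r +ω + 1)) (trans (cong ι (sym ac′≡N)) (ι-* a c′))
        ... | no c′≮a = reduced⇒Principal₂ a r c′ ac′≡N ∣2r+1∣≤∣a∣ (ℕ.≮⇒≥ c′≮a)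

    coprime-principal : ∀ n u v s₁ s₂ s₃ → n ≢ + 0 → s₁ * n + s₂ * u + s₃ * v ≡ + 1 → Principal₂ (ι n) (u +ω v)
    coprime-principal n u v s₁ s₂ s₃ n≢0 coprime with B+ω∈⟨n,u+vω⟩ n u v s₁ s₂ s₃ coprime
    ... | B , β∈ with gcd₃ n (norm (B +ω + 1)) (u - v * B)
    ...   | record { g = a ; s₁ = t₁ ; s₂ = t₂ ; s₃ = t₃ ; x/g = n/a ; y/g = N/a ; z/g = m/a
                   ; g≡s₁x+s₂y+s₃z = a≡ ; x≡x/g*g = n≡ ; y≡y/g*g = N≡ ; z≡z/g*g = m≡ } =
      Principal₂-resp ιa∈ β∈ ιn∈ w∈ (primitive-principal a B N/a a≢0 (trans (ℤ.*-comm a N/a) (sym N≡)))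
      where
      β = B +ω + 1
      w = u +ω v
      w≡ : w ≡ ι v ⊗ β ⊕ ι (u - v * B)
      w≡ = ≡ω (expand-re u v B (+ k)) (expand-im v B)
        where
        expand-re : ∀ u v B k → u ≡ v * B + + 0 * + 1 * k + (u - v * B)
        expand-re = solve-∀
        expand-im : ∀ v B → v ≡ v * + 1 + + 0 * B + + 0 * + 1 + + 0
        expand-im = solve-∀
      a≢0 : a ≢ + 0
      a≢0 a≡0 = n≢0 (trans n≡ (trans (cong (n/a *_) a≡0) (ℤ.*-zeroʳ n/a)))
      ιn∈ : ι n ∈⟨ ι a , β ⟩
      ιn∈ = ∈-resp (sym (trans (cong ι n≡) (ι-* n/a a))) (∈-⊗ (ι n/a) ∈-left)
      w∈ : w ∈⟨ ι a , β ⟩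
      w∈ = ι m/a , ι v , trans w≡ (trans (cong (ι v ⊗ β ⊕_) (trans (cong ι m≡) (ι-* m/a a))) (⊕-comm (ι v ⊗ β) (ι m/a ⊗ ι a)))
      ιa∈ : ι a ∈⟨ ι n , w ⟩
      ιa∈ = ∈-resp (sym ιa≡) (∈-⊕ (∈-⊕ (∈-⊗ (ι t₁) ∈-left) (∈-⊗ (ι t₂) ιN∈)) (∈-⊗ (ι t₃) ιm∈))
        where
        ιa≡ : ι a ≡ ι t₁ ⊗ ι n ⊕ ι t₂ ⊗ ι (norm β) ⊕ ι t₃ ⊗ ι (u - v * B)
        ιa≡ = trans (cong ι a≡) (cong₂ _⊕_ (cong₂ _⊕_ (ι-* t₁ n) (ι-* t₂ (norm β))) (ι-* t₃ (u - v * B)))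
        ιN∈ : ι (norm β) ∈⟨ ι n , w ⟩
        ιN∈ = ∈-resp (trans (⊗-comm (conj β) β) (x⊗conj[x]≡ι[norm[x]] β)) (∈-⊗ (conj β) β∈)
        ιm∈ : ι (u - v * B) ∈⟨ ι n , w ⟩
        ιm∈ = ∈-resp (sym (x≡y⊕z⇒z≡x⊖y w≡)) (∈-⊕ ∈-right (∈-⊖ (∈-⊗ (ι v) β∈)))

    ι-principal : ∀ n w → n ≢ + 0 → Principal₂ (ι n) w
    ι-principal n (u +ω v) n≢0 with gcd₃ n u v
    ... | record { g = g ; s₁ = s₁ ; s₂ = s₂ ; s₃ = s₃ ; x/g = n/g ; y/g = u/g ; z/g = v/g
                 ; g≡s₁x+s₂y+s₃z = g≡ ; x≡x/g*g = n≡ ; y≡y/g*g = u≡ ; z≡z/g*g = v≡ } =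
      subst₂ Principal₂ ιg⊗ιn/g≡ιn ιg⊗w/g≡w (Principal₂-scale (ι g) (coprime-principal n/g u/g v/g s₁ s₂ s₃ n/g≢0 coprime))
      where
      g≢0 : g ≢ + 0
      g≢0 g≡0 = n≢0 (trans n≡ (trans (cong (n/g *_) g≡0) (ℤ.*-zeroʳ n/g)))
      n/g≢0 : n/g ≢ + 0
      n/g≢0 n/g≡0 = n≢0 (trans n≡ (cong (_* g) n/g≡0))
      coprime : s₁ * n/g + s₂ * u/g + s₃ * v/g ≡ + 1
      coprime = ℤ.*-cancelˡ-≡ g _ _ {{ℤ.≢-nonZero g≢0}} (begin
        g * (s₁ * n/g + s₂ * u/g + s₃ * v/g)       ≡⟨ regroup g s₁ s₂ s₃ n/g u/g v/g ⟩
        s₁ * (n/g * g) + s₂ * (u/g * g) + s₃ * (v/g * g) ≡⟨ cong₂ (λ x y → s₁ * x + s₂ * y + s₃ * (v/g * g)) n≡ u≡ ⟨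
        s₁ * n + s₂ * u + s₃ * (v/g * g)           ≡⟨ cong (λ z → s₁ * n + s₂ * u + s₃ * z) v≡ ⟨
        s₁ * n + s₂ * u + s₃ * v                   ≡⟨ g≡ ⟨
        g                                          ≡⟨ ℤ.*-identityʳ g ⟨
        g * + 1                                    ∎)
        where
        open ≡-Reasoning
        regroup : ∀ g s₁ s₂ s₃ n u v → g * (s₁ * n + s₂ * u + s₃ * v) ≡ s₁ * (n * g) + s₂ * (u * g) + s₃ * (v * g)
        regroup = solve-∀
      ιg⊗ιn/g≡ιn : ι g ⊗ ι n/g ≡ ι n
      ιg⊗ιn/g≡ιn = trans (sym (ι-* g n/g)) (cong ι (trans (ℤ.*-comm g n/g) (sym n≡)))
      ιg⊗w/g≡w : ι g ⊗ (u/g +ω v/g) ≡ u +ω v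
      ιg⊗w/g≡w = trans (ι⊗ g u/g v/g) (≡ω (trans (ℤ.*-comm g u/g) (sym u≡)) (trans (ℤ.*-comm g v/g) (sym v≡)))

    principal₂ : ∀ a b → Principal₂ a b
    principal₂ a b with norm a ℤ.≟ + 0
    ... | yes Na≡0 = subst (λ a → Principal₂ a b) (sym (anisotropic a Na≡0)) (Principal₂-0ˡ b)
    ... | no Na≢0 = Principal₂-cancel (λ Nā≡0 → Na≢0 (trans (sym (norm-conj a)) Nā≡0))
                      (subst (λ c → Principal₂ c (conj a ⊗ b)) ιNa≡āa (ι-principal (norm a) (conj a ⊗ b) Na≢0))
      where
      ιNa≡āa : ι (norm a) ≡ conj a ⊗ a
      ιNa≡āa = trans (sym (x⊗conj[x]≡ι[norm[x]] a)) (⊗-comm a (conj a))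

    classNumberOne : ClassNumberOne (+ 4 * + k + + 1)
    classNumberOne = Transfer.principal⇒classNumberOne (+ k) (principal-pairs⇒principal principal₂)

-- Class number one for D = 13, 69 and 93

4a²≤n⇒a≤m : ∀ a {n} m → 4 ℕ.* (a ℕ.* a) ℕ.≤ n → n ℕ.< 4 ℕ.* (suc m ℕ.* suc m) → a ℕ.≤ m
4a²≤n⇒a≤m a m 4a²≤n n<4[m+1]² with a ℕ.≤? m
... | yes a≤m = a≤m
... | no a≰m = ⊥-elim (ℕ.<⇒≱ n<4[m+1]² (ℕ.≤-trans (ℕ.*-monoʳ-≤ 4 (ℕ.*-mono-≤ (ℕ.≰⇒> a≰m) (ℕ.≰⇒> a≰m))) 4a²≤n))

2B<a≤2[m+1]⇒B≤m : ∀ {a} B m → 2 ℕ.* B ℕ.< a → a ℕ.≤ 2 ℕ.* suc m → B ℕ.≤ m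
2B<a≤2[m+1]⇒B≤m B m 2B<a a≤2[m+1] = ℕ.≤-pred (ℕ.*-cancelˡ-< 2 B (suc m) (ℕ.<-≤-trans 2B<a a≤2[m+1]))

classNumberOne₁₃ : ClassNumberOne (+ 13)
classNumberOne₁₃ = Reduction.classNumberOne 3 (Anisotropy.norm≡0⇒≡0ω (from-yes (prime? 13)) (from-no (13 ℕ.∣? 1)) 3 refl) reduced
  where
  open QuadraticIntegers (+ 3)
  reduced : ∀ a B → 4 ℕ.* (a ℕ.* a) ℕ.≤ 13 → 2 ℕ.* B ℕ.< a → + a ∣ norm (+ B +ω + 1) → Principal₂ (ι (+ a)) (+ B +ω + 1)
  reduced a B 4a²≤13 2B<a a∣N with 4a²≤n⇒a≤m a 1 4a²≤13 (from-yes (13 ℕ.<? 16))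
  reduced 1 0 _ _ _ | _ = Principal₂-1ˡ _
  reduced 1 (suc B) _ (s≤s ()) _ | _
  reduced (suc (suc _)) B _ _ _ | s≤s ()

-- For D = 69 and 93 the only reduced (a, B + ω) with a > 1 and a ∣ N(B + ω) is (3, 1 + ω) = (ω - 5).
classNumberOne₆₉ : ClassNumberOne (+ 69)
classNumberOne₆₉ = Reduction.classNumberOne 17 (Anisotropy.norm≡0⇒≡0ω (from-yes (prime? 3)) (from-no (3 ℕ.∣? 23)) 17 refl) reduced
  where
  open QuadraticIntegers (+ 17)
  reduced : ∀ a B → 4 ℕ.* (a ℕ.* a) ℕ.≤ 69 → 2 ℕ.* B ℕ.< a → + a ∣ norm (+ B +ω + 1) → Principal₂ (ι (+ a)) (+ B +ω + 1)
  reduced a B 4a²≤69 2B<a a∣N with 4a²≤n⇒a≤m a 4 4a²≤69 (from-yes (69 ℕ.<? 100))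
  ... | a≤4 with 2B<a≤2[m+1]⇒B≤m B 1 2B<a a≤4
  reduced 1 0 _ _ _ | _ | _ = Principal₂-1ˡ _
  reduced 2 0 _ _ 2∣17 | _ | _ = ⊥-elim (from-no (2 ℕ.∣? 17) 2∣17)
  reduced 3 0 _ _ 3∣17 | _ | _ = ⊥-elim (from-no (3 ℕ.∣? 17) 3∣17)
  reduced 3 1 _ _ _ | _ | _ = -[1+ 4 ] +ω + 1 , (ι -[1+ 1 ] , 1ω , refl) , (-[1+ 3 ] +ω -[1+ 0 ] , refl) , (-[1+ 6 ] +ω -[1+ 1 ] , refl)
  reduced 4 0 _ _ 4∣17 | _ | _ = ⊥-elim (from-no (4 ℕ.∣? 17) 4∣17)
  reduced 4 1 _ _ 4∣15 | _ | _ = ⊥-elim (from-no (4 ℕ.∣? 15) 4∣15)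
  reduced 0 _ _ () _ | _ | _
  reduced 1 1 _ (s≤s ()) _ | _ | _
  reduced 2 1 _ (s≤s (s≤s ())) _ | _ | _
  reduced _ (suc (suc _)) _ _ _ | _ | s≤s ()
  reduced (suc (suc (suc (suc (suc _))))) _ _ _ _ | s≤s (s≤s (s≤s (s≤s ()))) | _

classNumberOne₉₃ : ClassNumberOne (+ 93)
classNumberOne₉₃ = Reduction.classNumberOne 23 (Anisotropy.norm≡0⇒≡0ω (from-yes (prime? 3)) (from-no (3 ℕ.∣? 31)) 23 refl) reduced
  where
  open QuadraticIntegers (+ 23)
  reduced : ∀ a B → 4 ℕ.* (a ℕ.* a) ℕ.≤ 93 → 2 ℕ.* B ℕ.< a → + a ∣ norm (+ B +ω + 1) → Principal₂ (ι (+ a)) (+ B +ω + 1)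
  reduced a B 4a²≤93 2B<a a∣N with 4a²≤n⇒a≤m a 4 4a²≤93 (from-yes (93 ℕ.<? 100))
  ... | a≤4 with 2B<a≤2[m+1]⇒B≤m B 1 2B<a a≤4
  reduced 1 0 _ _ _ | _ | _ = Principal₂-1ˡ _
  reduced 2 0 _ _ 2∣23 | _ | _ = ⊥-elim (from-no (2 ℕ.∣? 23) 2∣23)
  reduced 3 0 _ _ 3∣23 | _ | _ = ⊥-elim (from-no (3 ℕ.∣? 23) 3∣23)
  reduced 3 1 _ _ _ | _ | _ = -[1+ 4 ] +ω + 1 , (ι -[1+ 1 ] , 1ω , refl) , (+ 4 +ω + 1 , refl) , (+ 9 +ω + 2 , refl)
  reduced 4 0 _ _ 4∣23 | _ | _ = ⊥-elim (from-no (4 ℕ.∣? 23) 4∣23)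
  reduced 4 1 _ _ 4∣21 | _ | _ = ⊥-elim (from-no (4 ℕ.∣? 21) 4∣21)
  reduced 0 _ _ () _ | _ | _
  reduced 1 1 _ (s≤s ()) _ | _ | _
  reduced 2 1 _ (s≤s (s≤s ())) _ | _ | _
  reduced _ (suc (suc _)) _ _ _ | _ | s≤s ()
  reduced (suc (suc (suc (suc (suc _))))) _ _ _ _ | s≤s (s≤s (s≤s (s≤s ()))) | _

-- No element of norm ±3 when |9m + 2| ≥ 31

-- 9x² + 4y² = t²y² ± 108 is what x² - d y² = ±12 becomes when t² = 9d + 4.
Pell±108 : ℕ → ℕ → ℕ → Set
Pell±108 t x y = 9 ℕ.* (x ℕ.* x) ℕ.+ 4 ℕ.* (y ℕ.* y) ≡ t ℕ.* t ℕ.* (y ℕ.* y) ℕ.+ 108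
               ⊎ 9 ℕ.* (x ℕ.* x) ℕ.+ 4 ℕ.* (y ℕ.* y) ℕ.+ 108 ≡ t ℕ.* t ℕ.* (y ℕ.* y)

Pell±108⇒≤ : ∀ {t x y} → Pell±108 t x y → 9 ℕ.* (x ℕ.* x) ℕ.+ 4 ℕ.* (y ℕ.* y) ℕ.≤ t ℕ.* t ℕ.* (y ℕ.* y) ℕ.+ 108
Pell±108⇒≤ (inj₁ eq) = ℕ.≤-reflexive eq
Pell±108⇒≤ (inj₂ eq) = ℕ.≤-trans (ℕ.m≤m+n _ 108) (ℕ.≤-trans (ℕ.≤-reflexive eq) (ℕ.m≤m+n _ 108))

module _ {t : ℕ} (31≤t : 31 ℕ.≤ t) where
  open ℕ.≤-Reasoning

  3x<ty+2y : ∀ {x y} → 1 ℕ.≤ y → Pell±108 t x y → 3 ℕ.* x ℕ.< t ℕ.* y ℕ.+ 2 ℕ.* y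
  3x<ty+2y {x} {y} 1≤y pell with 3 ℕ.* x ℕ.<? t ℕ.* y ℕ.+ 2 ℕ.* y
  ... | yes 3x<ty+2y = 3x<ty+2y
  ... | no 3x≮ty+2y = ⊥-elim (ℕ.<⇒≱ (ℕ.≤-trans (from-yes (108 ℕ.<? 124)) (ℕ.*-monoʳ-≤ 4 31≤t)) 4t≤108)
    where
    ty+2y≤3x = ℕ.≮⇒≥ 3x≮ty+2y
    chain : t ℕ.* t ℕ.* (y ℕ.* y) ℕ.+ (4 ℕ.* t ℕ.* (y ℕ.* y) ℕ.+ 8 ℕ.* (y ℕ.* y)) ℕ.≤ t ℕ.* t ℕ.* (y ℕ.* y) ℕ.+ 108
    chain = begin
      t ℕ.* t ℕ.* (y ℕ.* y) ℕ.+ (4 ℕ.* t ℕ.* (y ℕ.* y) ℕ.+ 8 ℕ.* (y ℕ.* y)) ≡⟨ expand t y ⟩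
      (t ℕ.* y ℕ.+ 2 ℕ.* y) ℕ.* (t ℕ.* y ℕ.+ 2 ℕ.* y) ℕ.+ 4 ℕ.* (y ℕ.* y)   ≤⟨ ℕ.+-monoˡ-≤ _ (ℕ.*-mono-≤ ty+2y≤3x ty+2y≤3x) ⟩
      3 ℕ.* x ℕ.* (3 ℕ.* x) ℕ.+ 4 ℕ.* (y ℕ.* y)                             ≡⟨ cong (ℕ._+ 4 ℕ.* (y ℕ.* y)) (square x) ⟩
      9 ℕ.* (x ℕ.* x) ℕ.+ 4 ℕ.* (y ℕ.* y)                                   ≤⟨ Pell±108⇒≤ {t} {x} {y} pell ⟩
      t ℕ.* t ℕ.* (y ℕ.* y) ℕ.+ 108                                         ∎
      where
      expand : ∀ t y → t ℕ.* t ℕ.* (y ℕ.* y) ℕ.+ (4 ℕ.* t ℕ.* (y ℕ.* y) ℕ.+ 8 ℕ.* (y ℕ.* y))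
                     ≡ (t ℕ.* y ℕ.+ 2 ℕ.* y) ℕ.* (t ℕ.* y ℕ.+ 2 ℕ.* y) ℕ.+ 4 ℕ.* (y ℕ.* y)
      expand = ℕSolver.solve-∀
      square : ∀ x → 3 ℕ.* x ℕ.* (3 ℕ.* x) ≡ 9 ℕ.* (x ℕ.* x)
      square = ℕSolver.solve-∀
    4t≤108 : 4 ℕ.* t ℕ.≤ 108
    4t≤108 = begin
      4 ℕ.* t                                    ≤⟨ ℕ.m≤m*n (4 ℕ.* t) (y ℕ.* y) {{ℕ.>-nonZero (ℕ.*-mono-≤ 1≤y 1≤y)}} ⟩
      4 ℕ.* t ℕ.* (y ℕ.* y)                      ≤⟨ ℕ.m≤m+n _ _ ⟩
      4 ℕ.* t ℕ.* (y ℕ.* y) ℕ.+ 8 ℕ.* (y ℕ.* y)  ≤⟨ ℕ.+-cancelˡ-≤ _ _ _ chain ⟩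
      108                                        ∎

  ty<3x+2y : ∀ {x y} → 1 ℕ.≤ y → Pell±108 t x y → t ℕ.* y ℕ.< 3 ℕ.* x ℕ.+ 2 ℕ.* y
  ty<3x+2y {x} {y} 1≤y pell with t ℕ.* y ℕ.<? 3 ℕ.* x ℕ.+ 2 ℕ.* y
  ... | yes ty<3x+2y = ty<3x+2y
  ... | no ty≮3x+2y = ⊥-elim (by-sign pell)
    where
    square≤ : 9 ℕ.* (x ℕ.* x) ℕ.+ 4 ℕ.* (y ℕ.* y) ℕ.+ 12 ℕ.* (x ℕ.* y) ℕ.≤ t ℕ.* t ℕ.* (y ℕ.* y)
    square≤ = begin
      9 ℕ.* (x ℕ.* x) ℕ.+ 4 ℕ.* (y ℕ.* y) ℕ.+ 12 ℕ.* (x ℕ.* y) ≡⟨ expand x y ⟩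
      (3 ℕ.* x ℕ.+ 2 ℕ.* y) ℕ.* (3 ℕ.* x ℕ.+ 2 ℕ.* y)           ≤⟨ ℕ.*-mono-≤ (ℕ.≮⇒≥ ty≮3x+2y) (ℕ.≮⇒≥ ty≮3x+2y) ⟩
      t ℕ.* y ℕ.* (t ℕ.* y)                                    ≡⟨ square t y ⟩
      t ℕ.* t ℕ.* (y ℕ.* y)                                    ∎
      where
      expand : ∀ x y → 9 ℕ.* (x ℕ.* x) ℕ.+ 4 ℕ.* (y ℕ.* y) ℕ.+ 12 ℕ.* (x ℕ.* y)
                     ≡ (3 ℕ.* x ℕ.+ 2 ℕ.* y) ℕ.* (3 ℕ.* x ℕ.+ 2 ℕ.* y)
      expand = ℕSolver.solve-∀
      square : ∀ t y → t ℕ.* y ℕ.* (t ℕ.* y) ≡ t ℕ.* t ℕ.* (y ℕ.* y)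
      square = ℕSolver.solve-∀
    by-sign : Pell±108 t x y → ⊥
    by-sign (inj₁ eq) = ℕ.m+1+n≰m (t ℕ.* t ℕ.* (y ℕ.* y)) (begin
      t ℕ.* t ℕ.* (y ℕ.* y) ℕ.+ suc (107 ℕ.+ 12 ℕ.* (x ℕ.* y)) ≡⟨ regroup (t ℕ.* t ℕ.* (y ℕ.* y)) (12 ℕ.* (x ℕ.* y)) ⟩
      t ℕ.* t ℕ.* (y ℕ.* y) ℕ.+ 108 ℕ.+ 12 ℕ.* (x ℕ.* y)       ≡⟨ cong (ℕ._+ 12 ℕ.* (x ℕ.* y)) eq ⟨
      9 ℕ.* (x ℕ.* x) ℕ.+ 4 ℕ.* (y ℕ.* y) ℕ.+ 12 ℕ.* (x ℕ.* y) ≤⟨ square≤ ⟩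
      t ℕ.* t ℕ.* (y ℕ.* y)                                    ∎)
      where
      regroup : ∀ a b → a ℕ.+ suc (107 ℕ.+ b) ≡ a ℕ.+ 108 ℕ.+ b
      regroup = ℕSolver.solve-∀
    by-sign (inj₂ eq) = ℕ.<⇒≱ (from-yes (837 ℕ.<? 957)) (ℕ.+-cancelʳ-≤ (4 ℕ.* (y ℕ.* y)) _ _ (begin
      957 ℕ.+ 4 ℕ.* (y ℕ.* y)                    ≤⟨ ℕ.+-monoˡ-≤ _ (ℕ.m≤m*n 957 (y ℕ.* y) {{y²≢0}}) ⟩
      957 ℕ.* (y ℕ.* y) ℕ.+ 4 ℕ.* (y ℕ.* y)      ≡⟨ regroup (y ℕ.* y) ⟩
      (31 ℕ.* 31) ℕ.* (y ℕ.* y)                  ≤⟨ ℕ.*-monoˡ-≤ (y ℕ.* y) (ℕ.*-mono-≤ 31≤t 31≤t) ⟩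
      t ℕ.* t ℕ.* (y ℕ.* y)                      ≡⟨ eq ⟨
      9 ℕ.* (x ℕ.* x) ℕ.+ 4 ℕ.* (y ℕ.* y) ℕ.+ 108
        ≤⟨ ℕ.+-monoˡ-≤ 108 (ℕ.+-monoˡ-≤ (4 ℕ.* (y ℕ.* y)) (ℕ.*-monoʳ-≤ 9 (ℕ.*-mono-≤ x≤9 x≤9))) ⟩
      9 ℕ.* 81 ℕ.+ 4 ℕ.* (y ℕ.* y) ℕ.+ 108       ≡⟨ regroup′ (4 ℕ.* (y ℕ.* y)) ⟩
      837 ℕ.+ 4 ℕ.* (y ℕ.* y)                    ∎))
      where
      y²≢0 = ℕ.>-nonZero (ℕ.*-mono-≤ 1≤y 1≤y)
      regroup : ∀ z → 957 ℕ.* z ℕ.+ 4 ℕ.* z ≡ 31 ℕ.* 31 ℕ.* z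
      regroup = ℕSolver.solve-∀
      regroup′ : ∀ z → 9 ℕ.* 81 ℕ.+ z ℕ.+ 108 ≡ 837 ℕ.+ z
      regroup′ = ℕSolver.solve-∀
      12xy≤108 : 12 ℕ.* (x ℕ.* y) ℕ.≤ 108
      12xy≤108 = ℕ.+-cancelˡ-≤ (9 ℕ.* (x ℕ.* x) ℕ.+ 4 ℕ.* (y ℕ.* y)) _ _ (ℕ.≤-trans square≤ (ℕ.≤-reflexive (sym eq)))
      x≤9 : x ℕ.≤ 9
      x≤9 = ℕ.*-cancelˡ-≤ 12 (ℕ.≤-trans (ℕ.*-monoʳ-≤ 12 (ℕ.m≤m*n x y {{ℕ.>-nonZero 1≤y}})) 12xy≤108)

Pell±108-y≢0 : ∀ {t x} → ¬ Pell±108 t x 0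
Pell±108-y≢0 {t} {x} (inj₁ eq) = 9x²≢108 x (trans (sym (ℕ.+-identityʳ _)) (trans eq (cong (ℕ._+ 108) (ℕ.*-zeroʳ (t ℕ.* t)))))
  where
  9x²≢108 : ∀ x → 9 ℕ.* (x ℕ.* x) ≢ 108
  9x²≢108 0 ()
  9x²≢108 1 ()
  9x²≢108 2 ()
  9x²≢108 3 ()
  9x²≢108 (suc (suc (suc (suc x)))) eq = ℕ.<⇒≢ (ℕ.≤-trans (from-yes (108 ℕ.<? 144)) (ℕ.*-monoʳ-≤ 9 (ℕ.*-mono-≤ 4≤ 4≤))) (sym eq)
    where
    4≤ : 4 ℕ.≤ suc (suc (suc (suc x)))
    4≤ = s≤s (s≤s (s≤s (s≤s z≤n)))
Pell±108-y≢0 {t} {x} (inj₂ eq) = ℕ.1+n≢0 (ℕ.m+n≡0⇒n≡0 (9 ℕ.* (x ℕ.* x) ℕ.+ 0) (trans eq (ℕ.*-zeroʳ (t ℕ.* t))))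

pos-9x²+4y² : ∀ x y → + (9 ℕ.* (x ℕ.* x) ℕ.+ 4 ℕ.* (y ℕ.* y)) ≡ + 9 * (+ x * + x) + + 4 * (+ y * + y)
pos-9x²+4y² x y = trans (ℤ.pos-+ (9 ℕ.* (x ℕ.* x)) (4 ℕ.* (y ℕ.* y)))
  (cong₂ _+_ (trans (ℤ.pos-* 9 (x ℕ.* x)) (cong (+ 9 *_) (ℤ.pos-* x x))) (trans (ℤ.pos-* 4 (y ℕ.* y)) (cong (+ 4 *_) (ℤ.pos-* y y))))
pos-t²y² : ∀ t y → + (t ℕ.* t ℕ.* (y ℕ.* y)) ≡ + t * + t * (+ y * + y)
pos-t²y² t y = trans (ℤ.pos-* (t ℕ.* t) (y ℕ.* y)) (cong₂ _*_ (ℤ.pos-* t t) (ℤ.pos-* y y))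

module UnitDescent (k : ℤ) where
  open QuadraticIntegers k

  -- The four elements ±γ, ±conj γ share the norm and realise every sign of (trace, im).
  sign-normalise : ∀ γ → ∃[ γ₀ ] (norm γ₀ ≡ norm γ × trace γ₀ ≡ + ∣ trace γ ∣ × im γ₀ ≡ + ∣ im γ ∣)
  sign-normalise γ with trace γ in tr≡ | im γ in im≡
  ... | + m | + n = γ , refl , tr≡ , im≡
  ... | + m | -[1+ n ] = conj γ , norm-conj γ , trans (trace-conj γ) tr≡ , trans (im-conj γ) (cong -_ im≡)
  ... | -[1+ m ] | + n = ⊖ conj γ , trans (norm-⊖ (conj γ)) (norm-conj γ) , trans (trace-⊖ (conj γ)) (cong -_ (trans (trace-conj γ) tr≡))
                        , trans (im-⊖ (conj γ)) (trans (cong -_ (im-conj γ)) (trans (ℤ.neg-involutive (im γ)) im≡))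
  ... | -[1+ m ] | -[1+ n ] = ⊖ γ , norm-⊖ γ , trans (trace-⊖ γ) (cong -_ tr≡) , trans (im-⊖ γ) (cong -_ im≡)

  module _ {ε : ℤ[ω]} {t : ℕ} (31≤t : 31 ℕ.≤ t) (Nε≡1 : norm ε ≡ + 1) (trε≡t : trace ε ≡ + t) (imε≡-3 : im ε ≡ - + 3) where

    -- t² = 9D + 4 is 4 N ε = 4, as ε = (t + 3)/2 - 3ω.
    9X²+4Y²≡t²Y²+36N : ∀ γ → + 9 * (trace γ * trace γ) + + 4 * (im γ * im γ) ≡ + t * + t * (im γ * im γ) + + 36 * norm γ
    9X²+4Y²≡t²Y²+36N γ = begin
      + 9 * (X * X) + + 4 * (Y * Y)                 ≡⟨ split X Y D ⟩
      + 9 * (X * X - D * (Y * Y)) + (+ 4 + + 9 * D) * (Y * Y) ≡⟨ cong₂ (λ n s → + 9 * n + s * (Y * Y)) (sym (four-norm γ)) 4+9D≡t² ⟩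
      + 9 * (+ 4 * norm γ) + + t * + t * (Y * Y)      ≡⟨ regroup (norm γ) (+ t * + t * (Y * Y)) ⟩
      + t * + t * (Y * Y) + + 36 * norm γ             ∎
      where
      open ≡-Reasoning
      X = trace γ
      Y = im γ
      D = + 4 * k + + 1
      split : ∀ X Y D → + 9 * (X * X) + + 4 * (Y * Y) ≡ + 9 * (X * X - D * (Y * Y)) + (+ 4 + + 9 * D) * (Y * Y)
      split = solve-∀
      regroup : ∀ n s → + 9 * (+ 4 * n) + s ≡ s + + 36 * n
      regroup = solve-∀
      4+9D≡t² : + 4 + + 9 * D ≡ + t * + t
      4+9D≡t² = begin
        + 4 + + 9 * D                                    ≡⟨ expand D ⟩
        + 4 * + 1 + D * (- + 3 * - + 3)                  ≡⟨ cong₂ (λ n i → + 4 * n + D * (i * i)) Nε≡1 imε≡-3 ⟨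
        + 4 * norm ε + D * (im ε * im ε)                 ≡⟨ cong (_+ D * (im ε * im ε)) (four-norm ε) ⟩
        trace ε * trace ε - D * (im ε * im ε) + D * (im ε * im ε) ≡⟨ i≡i-j+j (trace ε * trace ε) (D * (im ε * im ε)) ⟨
        trace ε * trace ε                                ≡⟨ cong₂ _*_ trε≡t trε≡t ⟩
        + t * + t                                        ∎
        where
        expand : ∀ D → + 4 + + 9 * D ≡ + 4 * + 1 + D * (- + 3 * - + 3)
        expand = solve-∀

    norm±3⇒Pell±108 : ∀ γ x y → trace γ ≡ + x → im γ ≡ + y → norm γ ≡ + 3 ⊎ norm γ ≡ - + 3 → Pell±108 t x y
    norm±3⇒Pell±108 γ x y tr≡x im≡y N±3 = by-sign N±3
      where
      eq : + 9 * (+ x * + x) + + 4 * (+ y * + y) ≡ + t * + t * (+ y * + y) + + 36 * norm γ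
      eq = subst₂ (λ X Y → + 9 * (X * X) + + 4 * (Y * Y) ≡ + t * + t * (Y * Y) + + 36 * norm γ) tr≡x im≡y (9X²+4Y²≡t²Y²+36N γ)
      by-sign : norm γ ≡ + 3 ⊎ norm γ ≡ - + 3 → Pell±108 t x y
      by-sign (inj₁ N≡3) =
        inj₁ (ℤ.+-injective (trans (pos-9x²+4y² x y) (trans eq (trans (cong (λ n → + t * + t * (+ y * + y) + + 36 * n) N≡3)
                                                  (sym (trans (ℤ.pos-+ (t ℕ.* t ℕ.* (y ℕ.* y)) 108) (cong (_+ + 108) (pos-t²y² t y))))))))
      by-sign (inj₂ N≡-3) =
        inj₂ (ℤ.+-injective (trans (ℤ.pos-+ (9 ℕ.* (x ℕ.* x) ℕ.+ 4 ℕ.* (y ℕ.* y)) 108) (trans (cong (_+ + 108) (trans (pos-9x²+4y² x y) (trans eq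
               (cong (λ n → + t * + t * (+ y * + y) + + 36 * n) N≡-3)))) (trans (cancel (+ t * + t * (+ y * + y))) (sym (pos-t²y² t y))))))
        where
        cancel : ∀ b → b + + 36 * - + 3 + + 108 ≡ b
        cancel = solve-∀

    no-norm±3 : ∀ γ → ¬ (norm γ ≡ + 3 ⊎ norm γ ≡ - + 3)
    no-norm±3 γ = go γ (<-wellFounded ∣ im γ ∣)
      where
      go : ∀ γ → Acc ℕ._<_ ∣ im γ ∣ → ¬ (norm γ ≡ + 3 ⊎ norm γ ≡ - + 3)
      go γ (acc rec) N±3 with sign-normalise γ
      ... | γ₀ , Nγ₀≡Nγ , tr≡ , im≡ = descend ∣ im γ ∣ refl im≡
        where
        N₀±3 : norm γ₀ ≡ + 3 ⊎ norm γ₀ ≡ - + 3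
        N₀±3 = Sum.map (trans Nγ₀≡Nγ) (trans Nγ₀≡Nγ) N±3
        x = ∣ trace γ ∣
        descend : ∀ y → y ≡ ∣ im γ ∣ → im γ₀ ≡ + y → ⊥
        descend zero _ im≡0 = Pell±108-y≢0 {t} {x} (norm±3⇒Pell±108 γ₀ x 0 tr≡ im≡0 N₀±3)
        descend y@(suc _) y≡ im≡y = go γ₁ (rec (subst (∣ im γ₁ ∣ ℕ.<_) y≡ ∣im[γ₁]∣<y)) N₁±3
          where
          pell = norm±3⇒Pell±108 γ₀ x y tr≡ im≡y N₀±3
          γ₁ = γ₀ ⊗ ε
          N₁±3 : norm γ₁ ≡ + 3 ⊎ norm γ₁ ≡ - + 3
          N₁±3 = Sum.map (trans Nγ₁≡Nγ₀) (trans Nγ₁≡Nγ₀) N₀±3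
            where
            Nγ₁≡Nγ₀ = trans (norm-⊗ γ₀ ε) (trans (cong (norm γ₀ *_) Nε≡1) (ℤ.*-identityʳ (norm γ₀)))
          2im[γ₁]≡ : + 2 * im γ₁ ≡ (t ℕ.* y) ℤ.⊖ (3 ℕ.* x)
          2im[γ₁]≡ = begin
            + 2 * im γ₁                          ≡⟨ im-⊗ γ₀ ε ⟩
            trace γ₀ * im ε + im γ₀ * trace ε    ≡⟨ cong₂ _+_ (cong₂ _*_ tr≡ imε≡-3) (cong₂ _*_ im≡y trε≡t) ⟩
            + x * - + 3 + + y * + t              ≡⟨ regroup (+ x) (+ y) (+ t) ⟩
            + t * + y - + 3 * + x                ≡⟨ cong₂ _-_ (ℤ.pos-* t y) (ℤ.pos-* 3 x) ⟨
            + (t ℕ.* y) - + (3 ℕ.* x)            ≡⟨ ℤ.m-n≡m⊖n (t ℕ.* y) (3 ℕ.* x) ⟩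
            (t ℕ.* y) ℤ.⊖ (3 ℕ.* x)                ∎
            where
            open ≡-Reasoning
            regroup : ∀ x y t → x * - + 3 + y * t ≡ t * y - + 3 * x
            regroup = solve-∀
          ∣im[γ₁]∣<y : ∣ im γ₁ ∣ ℕ.< y
          ∣im[γ₁]∣<y = ℕ.*-cancelˡ-< 2 _ _ (subst (ℕ._< 2 ℕ.* y) (sym (trans (sym (ℤ.abs-* (+ 2) (im γ₁))) (cong ∣_∣ 2im[γ₁]≡)))
                          (∣m⊖n∣<o (t ℕ.* y) (3 ℕ.* x) (2 ℕ.* y)
                                   (ty<3x+2y 31≤t {x} {y} (s≤s z≤n) pell) (3x<ty+2y 31≤t {x} {y} (s≤s z≤n) pell)))

-- The ideal above 3

-- For m = 2j + 1 we have D = 9m² + 4m = 4k + 1, and the ideal (3, (m + √D)/2) = (3, j + ω).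
module IdealAboveThree (j : ℤ) where
  m = + 2 * j + + 1
  k = + 9 * j * j + + 11 * j + + 3
  open QuadraticIntegers k

  Dm≡4k+1 : Dm m ≡ + 4 * k + + 1
  Dm≡4k+1 = expand j
    where
    expand : ∀ j → + 9 * ((+ 2 * j + + 1) * (+ 2 * j + + 1)) + + 4 * (+ 2 * j + + 1) ≡ + 4 * (+ 9 * j * j + + 11 * j + + 3) + + 1
    expand = solve-∀

  3∣norm[j+ω] : ¬ (+ 3 ∣ m - + 2) → ∃[ h ] norm (j +ω + 1) ≡ + 3 * h
  3∣norm[j+ω] 3∤m-2 with ¬3∣m-2⇒3∣m[2m+1] m 3∤m-2
  ... | h , m[2m+1]≡3h = - h , trans (factor j) (trans (cong -_ m[2m+1]≡3h) (ℤ.neg-distribʳ-* (+ 3) h))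
    where
    factor : ∀ j → j * j + j * + 1 - (+ 9 * j * j + + 11 * j + + 3) * (+ 1 * + 1) ≡ - ((+ 2 * j + + 1) * (+ 2 * (+ 2 * j + + 1) + + 1))
    factor = solve-∀

  ε⁺ ε⁻ : ℤ[ω]
  ε⁺ = + 9 * j + + 7 +ω - + 3
  ε⁻ = - (+ 9 * j) - + 4 +ω - + 3

  trace[ε⁺] : trace ε⁺ ≡ + 18 * j + + 11
  trace[ε⁺] = expand j
    where
    expand : ∀ j → + 2 * (+ 9 * j + + 7) + - + 3 ≡ + 18 * j + + 11
    expand = solve-∀

  trace[ε⁻] : trace ε⁻ ≡ - (+ 18 * j + + 11)
  trace[ε⁻] = expand j
    where
    expand : ∀ j → + 2 * (- (+ 9 * j) - + 4) + - + 3 ≡ - (+ 18 * j + + 11)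
    expand = solve-∀

  norm[ε⁺]≡1 : norm ε⁺ ≡ + 1
  norm[ε⁺]≡1 = expand j
    where
    expand : ∀ j → (+ 9 * j + + 7) * (+ 9 * j + + 7) + (+ 9 * j + + 7) * - + 3 - (+ 9 * j * j + + 11 * j + + 3) * (- + 3 * - + 3) ≡ + 1
    expand = solve-∀

  norm[ε⁻]≡1 : norm ε⁻ ≡ + 1
  norm[ε⁻]≡1 = expand j
    where
    expand : ∀ j → (- (+ 9 * j) - + 4) * (- (+ 9 * j) - + 4) + (- (+ 9 * j) - + 4) * - + 3 - (+ 9 * j * j + + 11 * j + + 3) * (- + 3 * - + 3) ≡ + 1
    expand = solve-∀

  ⟨3,j+ω⟩-principal : ClassNumberOne (Dm m) → Principal₂ (ι (+ 3)) (j +ω + 1)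
  ⟨3,j+ω⟩-principal cn = principal⇒Principal₂ (Transfer.classNumberOne⇒principal k (subst ClassNumberOne Dm≡4k+1 cn) (ι (+ 3) ∷ (j +ω + 1) ∷ []))

  norm±3-element : ¬ (+ 3 ∣ m - + 2) → ClassNumberOne (Dm m) → ∃[ γ ] (norm γ ≡ + 3 ⊎ norm γ ≡ - + 3)
  norm±3-element 3∤m-2 cn = generator-of-⟨3,g⟩ (3∣norm[j+ω] 3∤m-2) refl (⟨3,j+ω⟩-principal cn)

  not-classNumberOne : ¬ (+ 3 ∣ m - + 2) → ∀ ε {t} → 31 ℕ.≤ t → norm ε ≡ + 1 → trace ε ≡ + t → im ε ≡ - + 3 →
                       ¬ ClassNumberOne (Dm m)
  not-classNumberOne 3∤m-2 ε 31≤t Nε≡1 trε≡t imε≡-3 cn =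
    uncurry (UnitDescent.no-norm±3 k {ε} 31≤t Nε≡1 trε≡t imε≡-3) (norm±3-element 3∤m-2 cn)

classNumberOne⇒2j+1≡-3⊎1⊎3 : ∀ j → let m = + 2 * j + + 1 in
                            ¬ (+ 3 ∣ m - + 2) → ClassNumberOne (Dm m) → m ≡ - + 3 ⊎ m ≡ + 1 ⊎ m ≡ + 3
classNumberOne⇒2j+1≡-3⊎1⊎3 (+ 0) _ _ = inj₂ (inj₁ refl)
classNumberOne⇒2j+1≡-3⊎1⊎3 (+ 1) _ _ = inj₂ (inj₂ refl)
classNumberOne⇒2j+1≡-3⊎1⊎3 -[1+ 0 ] 3∤m-2 _ = ⊥-elim (3∤m-2 (ℕ.divides 1 refl))
classNumberOne⇒2j+1≡-3⊎1⊎3 -[1+ 1 ] _ _ = inj₁ refl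
classNumberOne⇒2j+1≡-3⊎1⊎3 j@(+ suc (suc n)) 3∤m-2 cn =
  ⊥-elim (not-classNumberOne 3∤m-2 ε⁺ 31≤t norm[ε⁺]≡1 (trans trace[ε⁺] t≡) refl cn)
  where
  open IdealAboveThree j
  t = 18 ℕ.* suc (suc n) ℕ.+ 11
  31≤t : 31 ℕ.≤ t
  31≤t = ℕ.≤-trans (from-yes (31 ℕ.≤? 47)) (ℕ.+-monoˡ-≤ 11 (ℕ.*-monoʳ-≤ 18 (s≤s (s≤s z≤n))))
  t≡ : + 18 * j + + 11 ≡ + t
  t≡ = sym (trans (ℤ.pos-+ (18 ℕ.* suc (suc n)) 11) (cong (_+ + 11) (ℤ.pos-* 18 (suc (suc n)))))
classNumberOne⇒2j+1≡-3⊎1⊎3 j@(-[1+ suc (suc n) ]) 3∤m-2 cn =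
  ⊥-elim (not-classNumberOne 3∤m-2 ε⁻ 31≤t norm[ε⁻]≡1 (trans trace[ε⁻] t≡) refl cn)
  where
  open IdealAboveThree j
  t = 18 ℕ.* suc (suc n) ℕ.+ 7
  31≤t : 31 ℕ.≤ t
  31≤t = ℕ.≤-trans (from-yes (31 ℕ.≤? 43)) (ℕ.+-monoˡ-≤ 7 (ℕ.*-monoʳ-≤ 18 (s≤s (s≤s z≤n))))
  t≡ : - (+ 18 * j + + 11) ≡ + t
  t≡ = trans (negate (+ suc (suc n))) (sym (trans (ℤ.pos-+ (18 ℕ.* suc (suc n)) 7) (cong (_+ + 7) (ℤ.pos-* 18 (suc (suc n))))))
    where
    negate : ∀ n → - (+ 18 * - (+ 1 + n) + + 11) ≡ + 18 * n + + 7
    negate = solve-∀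

classNumberOne⇒m≡-3⊎1⊎3 : ∀ m → Odd m → ¬ (+ 3 ∣ m - + 2) → ClassNumberOne (Dm m) → m ≡ - + 3 ⊎ m ≡ + 1 ⊎ m ≡ + 3
classNumberOne⇒m≡-3⊎1⊎3 m odd with odd⇒≡2j+1 m odd
... | j , refl = classNumberOne⇒2j+1≡-3⊎1⊎3 j

m≡-3⊎1⊎3⇒classNumberOne : ∀ m → m ≡ - + 3 ⊎ m ≡ + 1 ⊎ m ≡ + 3 → ClassNumberOne (Dm m)
m≡-3⊎1⊎3⇒classNumberOne _ (inj₁ refl) = classNumberOne₆₉
m≡-3⊎1⊎3⇒classNumberOne _ (inj₂ (inj₁ refl)) = classNumberOne₁₃
m≡-3⊎1⊎3⇒classNumberOne _ (inj₂ (inj₂ refl)) = classNumberOne₉₃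

-- ClassNumberOne speaks of ideals of ℤ[(1 + √D)/2] directly.
theorem1p1 : (m : ℤ) → Odd m → ¬ ((+ 3) ∣ (m - (+ 2))) → SquareFree (Dm m)
    → (ClassNumberOne (Dm m) → (m ≡ - (+ 3) ⊎ m ≡ + 1 ⊎ m ≡ + 3))
      × ((m ≡ - (+ 3) ⊎ m ≡ + 1 ⊎ m ≡ + 3) → ClassNumberOne (Dm m))
theorem1p1 m odd 3∤m-2 _ = classNumberOne⇒m≡-3⊎1⊎3 m odd 3∤m-2 , m≡-3⊎1⊎3⇒classNumberOne m
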